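{- Let $k\ge1$ and $n\ge1$. There is a bijection between the set of ascending (weakly increasing) $k$-Naples parking functions of length $n$ and the set of Dyck paths of length $n+k$ whose first $k$ steps are Up, whose last $k+1$ steps are Down, and such that, for every Down step occurring before the last $k+1$ steps that puts the path below the line $y=k$ (from height $k$ to height $k-1$), there is a point within the following $2k$ steps at which, counted from just after that Down step, there have been two more Up steps than Down steps.
   Context: A Dyck path of length $m$ is a lattice path from $(0,0)$ to $(2m,0)$ with $m$ Up steps $(1,1)$ and $m$ Down steps $(1,-1)$ never going below $y=0$. Parking rules: $n$ spots $1,\dots,n$; cars $c_1,\dots,c_n$ arrive in order with preferences $a_j\in[n]$; $k$-Naples rule: $c_j$ parks at $a_j$ if empty, otherwise checks spots $a_j-1,\dots,a_j-k$ (those $\ge1$) in order and parks in the first empty one, otherwise drives forward from $a_j$ and parks in the first empty spot after $a_j$ (failing if none). A preference is a $k$-Naples parking function if all cars park. -}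

module Defs where

open import Data.Nat using (ℕ; zero; suc; _+_; _*_; _∸_; _≤_; _<_; _≡ᵇ_; _<ᵇ_)
open import Data.Integer using (ℤ; +_; -[1+_]) renaming (_+_ to _+ℤ_; _≤_ to _≤ℤ_)
open import Data.Bool using (Bool; true; false; if_then_else_; _∨_)
open import Data.List using (List; []; _∷_; length; take; drop; replicate; applyUpTo; filterᵇ; _++_)
open import Data.List.Relation.Unary.All using (All)
open import Data.List.Relation.Unary.Linked using (Linked)
open import Data.Maybe using (Maybe; just; nothing)
open import Data.Product using (_×_; ∃)
open import Relation.Binary.PropositionalEquality using (_≡_)

elem : ℕ → List ℕ → Bool
elem s []       = false
elem s (x ∷ xs) = (s ≡ᵇ x) ∨ elem s xs

firstFree : List ℕ → List ℕ → Maybe ℕ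
firstFree occ []       = nothing
firstFree occ (s ∷ ss) = if elem s occ then firstFree occ ss else just s

backCands : ℕ → ℕ → List ℕ
backCands k a = filterᵇ (λ s → 0 <ᵇ s) (applyUpTo (λ i → a ∸ suc i) k)

fwdCands : ℕ → ℕ → List ℕ
fwdCands n a = applyUpTo (λ i → a + suc i) (n ∸ a)

naplesSpot : ℕ → ℕ → List ℕ → ℕ → Maybe ℕ
naplesSpot k n occ a = firstFree occ (a ∷ backCands k a ++ fwdCands n a)

parkAll : ℕ → ℕ → List ℕ → List ℕ → Maybe (List ℕ)
parkAll k n occ []       = just occ
parkAll k n occ (a ∷ as) with naplesSpot k n occ a
... | nothing = nothing
... | just s  = parkAll k n (s ∷ occ) as

IsNaplesPF : ℕ → ℕ → List ℕ → Set
IsNaplesPF k n α =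
  length α ≡ n × All (λ a → 1 ≤ a × a ≤ n) α × ∃ (λ occ → parkAll k n [] α ≡ just occ)

IsAscNaplesPF : ℕ → ℕ → List ℕ → Set
IsAscNaplesPF k n α = Linked _≤_ α × IsNaplesPF k n α

data Step : Set where
  U D : Step

stepVal : Step → ℤ
stepVal U = + 1
stepVal D = -[1+ 0 ]

height : List Step → ℤ
height []       = + 0
height (s ∷ ss) = stepVal s +ℤ height ss

IsDyck : ℕ → List Step → Set
IsDyck m p =
  length p ≡ 2 * m × height p ≡ + 0 × (∀ i → + 0 ≤ℤ height (take i p))

IsCorPath : ℕ → ℕ → List Step → Set
IsCorPath k n p =
  IsDyck (n + k) p
  × take k p ≡ replicate k U
  × drop (length p ∸ suc k) p ≡ replicate (suc k) D
  × (∀ i rest →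
       i < length p ∸ suc k →          -- step i+1 is before the last k+1 steps
       drop i p ≡ D ∷ rest →           -- step i+1 is a Down step
       height (take i p) ≡ + k →       -- going from height k to height k-1
       ∃ λ j → 1 ≤ j × j ≤ 2 * k × j ≤ length rest
             × height (take j rest) ≡ + 2)

{-# OPTIONS --safe #-}
-- An ascending preference list is read as a lattice word: a D step for each spot
-- and a U step for each car, taken at the spot it prefers; the path of the family
-- is this word framed by k up steps and k down steps. For ascending preferences the
-- k-Naples rule only needs the cursor (the spot preferred by the next car), the block
-- of occupied spots starting at the cursor and the stack of holes behind it: a car
-- parks at the cursor, else in the largest hole if it is at most k spots back, else
-- right after the block. Along a run the height of the framed path is
-- k + block − #holes. If every car parks, every hole is filled while still within
-- reach, so there are at most k holes and the path stays nonnegative; and a down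
-- step from height k to k − 1 leaves exactly one hole, whose filling, at most k
-- spots later, brings the path up by two within 2k steps. Conversely these window
-- conditions let the machine, and hence the Naples rule, park every car, and the
-- encoding is inverted by reading off the spots of the U steps.
module Submission where

open import Defs
open import Data.Bool using (Bool; true; false; T)
open import Data.Empty using (⊥; ⊥-elim)
open import Data.Integer using (-[1+_]; _⊖_; +≤+) renaming (+_ to pos; _+_ to _+ℤ_; _≤_ to _≤ℤ_; _<_ to _<ℤ_)
import Data.Integer.Properties as ℤ
open import Data.List using (List; []; _∷_; length; take; drop; replicate; _++_; applyUpTo; filterᵇ)
open import Data.List.Properties
  using (length-++; ++-assoc; ++-identityʳ; length-replicate; take++drop≡id; take-take; length-take; ∷-injectiveʳ)
open import Data.List.Membership.Propositional using (_∈_)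
open import Data.List.Membership.Propositional.Properties using (∈-++⁺ʳ)
open import Data.List.Relation.Unary.All as All using (All; []; _∷_)
open import Data.List.Relation.Unary.Any using (here; there)
open import Data.List.Relation.Unary.Linked as Linked using (Linked; []; [-]; _∷_)
open import Data.List.Relation.Unary.Linked.Properties using (Linked⇒All)
open import Data.Maybe using (Maybe; just; nothing)
open import Data.Maybe.Properties using (just-injective)
open import Data.Nat using (ℕ; zero; suc; _+_; _*_; _∸_; _≤_; _<_; _>_; z≤n; s≤s; s≤s⁻¹; pred; _≤?_; _≟_; _≡ᵇ_; _<ᵇ_)
open import Data.Nat.Properties
open import Data.Nat.Tactic.RingSolver using (solve-∀)
open import Data.Product using (_×_; _,_; ∃; ∃₂; proj₁; proj₂)
open import Data.Sum using (_⊎_; inj₁; inj₂)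
open import Data.Unit using (⊤; tt)
open import Function using (case_of_)
open import Function.Bundles using (_⇔_; mk⇔; Equivalence)
open import Function.Construct.Composition using (_⇔-∘_)
open import Relation.Nullary using (¬_; yes; no)
open import Relation.Binary.PropositionalEquality

take-++-≤ : ∀ {A : Set} j (xs ys : List A) → j ≤ length xs → take j (xs ++ ys) ≡ take j xs
take-++-≤ zero    xs       ys _         = refl
take-++-≤ (suc j) (x ∷ xs) ys (s≤s j≤) = cong (x ∷_) (take-++-≤ j xs ys j≤)

take-replicate-++ : ∀ {A : Set} k (x : A) ys → take k (replicate k x ++ ys) ≡ replicate k x
take-replicate-++ zero    x ys = refl
take-replicate-++ (suc k) x ys = cong (x ∷_) (take-replicate-++ k x ys)

drop-replicate-++ : ∀ {A : Set} k (x : A) ys → drop k (replicate k x ++ ys) ≡ ys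
drop-replicate-++ zero    x ys = refl
drop-replicate-++ (suc k) x ys = drop-replicate-++ k x ys

drop-length-++ : ∀ {A : Set} (xs ys : List A) → drop (length xs) (xs ++ ys) ≡ ys
drop-length-++ []       ys = refl
drop-length-++ (x ∷ xs) ys = drop-length-++ xs ys

replicate-++-∷ : ∀ {A : Set} m (x : A) ys → replicate m x ++ x ∷ ys ≡ x ∷ replicate m x ++ ys
replicate-++-∷ zero    x ys = refl
replicate-++-∷ (suc m) x ys = cong (x ∷_) (replicate-++-∷ m x ys)

length-take-≤ : ∀ {A : Set} j (xs : List A) → j ≤ length xs → length (take j xs) ≡ j
length-take-≤ j xs j≤ = trans (length-take j xs) (m≤n⇒m⊓n≡m j≤)

Linked-≤-head : ∀ {a as} → Linked _≤_ (a ∷ as) → All (a ≤_) as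
Linked-≤-head l = All.tail (Linked⇒All ≤-trans ≤-refl l)

Linked-≤-∷ : ∀ {x ys} → All (x ≤_) ys → Linked _≤_ ys → Linked _≤_ (x ∷ ys)
Linked-≤-∷ []      []  = [-]
Linked-≤-∷ (x≤ ∷ _) l  = x≤ ∷ l

Linked->-∷ : ∀ {a F} → All (_< a) F → Linked _>_ F → Linked _>_ (a ∷ F)
Linked->-∷ []        [] = [-]
Linked->-∷ (x<a ∷ _) l  = x<a ∷ l

Linked->-head : ∀ {t F} → Linked _>_ (t ∷ F) → All (_< t) F
Linked->-head [-]       = []
Linked->-head (t>y ∷ l) = Linked⇒All (λ y<x z<y → <-trans z<y y<x) t>y l

++-∷ʳ-≢-[] : ∀ {A : Set} (G : List A) x → G ++ x ∷ [] ≢ []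
++-∷ʳ-≢-[] []      x ()
++-∷ʳ-≢-[] (_ ∷ G) x ()

last-of : ∀ {A : Set} (x : A) xs → ∃₂ λ ys y → x ∷ xs ≡ ys ++ y ∷ []
last-of x []       = [] , x , refl
last-of x (x′ ∷ xs) with last-of x′ xs
... | ys , y , eq = x ∷ ys , y , cong (x ∷_) eq

Linked->-last : ∀ {t₀ F G f₀} → Linked _>_ (t₀ ∷ F) → t₀ ∷ F ≡ G ++ f₀ ∷ [] → f₀ ≤ t₀
Linked->-last {G = []}    _ refl = ≤-refl
Linked->-last {G = _ ∷ G} l refl = <⇒≤ (All.lookup (Linked->-head l) (∈-++⁺ʳ G (here refl)))

ups downs : List Step → ℕ
ups []       = 0
ups (U ∷ xs) = suc (ups xs)
ups (D ∷ xs) = ups xs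
downs []       = 0
downs (U ∷ xs) = downs xs
downs (D ∷ xs) = suc (downs xs)

height≡ups⊖downs : ∀ xs → height xs ≡ ups xs ⊖ downs xs
height≡ups⊖downs []       = refl
height≡ups⊖downs (U ∷ xs) =
  trans (cong (pos 1 +ℤ_) (height≡ups⊖downs xs)) (ℤ.distribʳ-⊖-+-pos 1 (ups xs) (downs xs))
height≡ups⊖downs (D ∷ xs) =
  trans (cong (-[1+ 0 ] +ℤ_) (height≡ups⊖downs xs)) (ℤ.distribʳ-⊖-+-neg 0 (ups xs) (downs xs))

length≡ups+downs : ∀ xs → length xs ≡ ups xs + downs xs
length≡ups+downs []       = refl
length≡ups+downs (U ∷ xs) = cong suc (length≡ups+downs xs)
length≡ups+downs (D ∷ xs) = trans (cong suc (length≡ups+downs xs)) (sym (+-suc (ups xs) (downs xs)))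

ups-++ : ∀ xs ys → ups (xs ++ ys) ≡ ups xs + ups ys
ups-++ []       ys = refl
ups-++ (U ∷ xs) ys = cong suc (ups-++ xs ys)
ups-++ (D ∷ xs) ys = ups-++ xs ys

downs-++ : ∀ xs ys → downs (xs ++ ys) ≡ downs xs + downs ys
downs-++ []       ys = refl
downs-++ (U ∷ xs) ys = downs-++ xs ys
downs-++ (D ∷ xs) ys = cong suc (downs-++ xs ys)

ups-replicate-U : ∀ m → ups (replicate m U) ≡ m
ups-replicate-U zero    = refl
ups-replicate-U (suc m) = cong suc (ups-replicate-U m)

ups-replicate-D : ∀ m → ups (replicate m D) ≡ 0
ups-replicate-D zero    = refl
ups-replicate-D (suc m) = ups-replicate-D m

downs-replicate-U : ∀ m → downs (replicate m U) ≡ 0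
downs-replicate-U zero    = refl
downs-replicate-U (suc m) = downs-replicate-U m

downs-replicate-D : ∀ m → downs (replicate m D) ≡ m
downs-replicate-D zero    = refl
downs-replicate-D (suc m) = cong suc (downs-replicate-D m)

0≤⊖⇒≤ : ∀ u d → pos 0 ≤ℤ u ⊖ d → d ≤ u
0≤⊖⇒≤ u d 0≤u⊖d with d ≤? u
... | yes d≤u = d≤u
... | no  d≰u = ⊥-elim (ℤ.≤⇒≯ 0≤u⊖d (subst (u ⊖ d <ℤ_) (ℤ.n⊖n≡0 d) (ℤ.⊖-monoˡ-< d (≰⇒> d≰u))))

≤⇒0≤⊖ : ∀ u d → d ≤ u → pos 0 ≤ℤ u ⊖ d
≤⇒0≤⊖ u d d≤u = subst (pos 0 ≤ℤ_) (sym (ℤ.⊖-≥ d≤u)) (+≤+ z≤n)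

⊖≡+⇒≡+ : ∀ u d c → u ⊖ d ≡ pos c → u ≡ d + c
⊖≡+⇒≡+ u d c eq = begin
  u             ≡⟨ m+[n∸m]≡n d≤u ⟨
  d + (u ∸ d)   ≡⟨ cong (d +_) (ℤ.+-injective (trans (sym (ℤ.⊖-≥ d≤u)) eq)) ⟩
  d + c         ∎
  where
  open ≡-Reasoning
  d≤u : d ≤ u
  d≤u = 0≤⊖⇒≤ u d (subst (pos 0 ≤ℤ_) (sym eq) (+≤+ z≤n))

≡+⇒⊖≡+ : ∀ u d c → u ≡ d + c → u ⊖ d ≡ pos c
≡+⇒⊖≡+ _ d c refl = trans (ℤ.⊖-≥ (m≤m+n d c)) (cong pos (m+n∸m≡n d c))

-- Weakly increasing sequences as lattice words

-- Read from spot p on, each D step moves on to the next spot, up to spot n + 1,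
-- and each entry a of the weakly increasing α is a U step taken at spot a.
encode : ℕ → ℕ → List ℕ → List Step
encode n p []       = replicate (suc n ∸ p) D
encode n p (a ∷ as) = replicate (a ∸ p) D ++ U ∷ encode n a as

decode : ℕ → List Step → List ℕ
decode p []      = []
decode p (D ∷ s) = decode (suc p) s
decode p (U ∷ s) = p ∷ decode p s

decode-++ : ∀ p xs ys → decode p (xs ++ ys) ≡ decode p xs ++ decode (p + downs xs) ys
decode-++ p []       ys = cong (λ q → decode q ys) (sym (+-identityʳ p))
decode-++ p (U ∷ xs) ys = cong (p ∷_) (decode-++ p xs ys)
decode-++ p (D ∷ xs) ys =
  trans (decode-++ (suc p) xs ys) (cong (λ q → decode (suc p) xs ++ decode q ys) (sym (+-suc p (downs xs))))

decode-replicate-D : ∀ p m → decode p (replicate m D) ≡ []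
decode-replicate-D p zero    = refl
decode-replicate-D p (suc m) = decode-replicate-D (suc p) m

decode-replicate-D-++ : ∀ p m ys → decode p (replicate m D ++ ys) ≡ decode (p + m) ys
decode-replicate-D-++ p zero    ys = cong (λ q → decode q ys) (sym (+-identityʳ p))
decode-replicate-D-++ p (suc m) ys =
  trans (decode-replicate-D-++ (suc p) m ys) (cong (λ q → decode q ys) (sym (+-suc p m)))

decode-encode : ∀ n p α → Linked _≤_ α → All (p ≤_) α → decode p (encode n p α) ≡ α
decode-encode n p []       _ _        = decode-replicate-D p (suc n ∸ p)
decode-encode n p (a ∷ as) l (p≤a ∷ _) = begin
  decode p (replicate (a ∸ p) D ++ U ∷ encode n a as) ≡⟨ decode-replicate-D-++ p (a ∸ p) _ ⟩
  decode (p + (a ∸ p)) (U ∷ encode n a as)           ≡⟨ cong (λ q → decode q (U ∷ encode n a as)) (m+[n∸m]≡n p≤a) ⟩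
  a ∷ decode a (encode n a as)                        ≡⟨ cong (a ∷_) (decode-encode n a as (Linked.tail l) (Linked-≤-head l)) ⟩
  a ∷ as                                              ∎
  where open ≡-Reasoning

encode-decode : ∀ n q p s → q ≤ p → p + downs s ≡ suc n →
  encode n q (decode p s) ≡ replicate (p ∸ q) D ++ s
encode-decode n q p []      q≤p eq rewrite +-identityʳ p | eq = sym (++-identityʳ _)
encode-decode n q p (U ∷ s) q≤p eq = cong (λ z → replicate (p ∸ q) D ++ U ∷ z)
  (trans (encode-decode n p p s ≤-refl eq) (cong (λ z → replicate z D ++ s) (n∸n≡0 p)))
encode-decode n q p (D ∷ s) q≤p eq =
  trans (encode-decode n q (suc p) s (m≤n⇒m≤1+n q≤p) (trans (sym (+-suc p (downs s))) eq))
    (trans (cong (λ z → replicate z D ++ s) (+-∸-assoc 1 q≤p)) (sym (replicate-++-∷ (p ∸ q) D s)))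

ups-encode : ∀ n p α → ups (encode n p α) ≡ length α
ups-encode n p []       = ups-replicate-D (suc n ∸ p)
ups-encode n p (a ∷ as) = begin
  ups (replicate (a ∸ p) D ++ U ∷ encode n a as)         ≡⟨ ups-++ (replicate (a ∸ p) D) _ ⟩
  ups (replicate (a ∸ p) D) + suc (ups (encode n a as))
    ≡⟨ cong₂ (λ x y → x + suc y) (ups-replicate-D (a ∸ p)) (ups-encode n a as) ⟩
  suc (length as)                                        ∎
  where open ≡-Reasoning

downs-encode : ∀ n p α → p ≤ suc n → Linked _≤_ α → All (p ≤_) α → All (_≤ n) α →
  downs (encode n p α) + p ≡ suc n
downs-encode n p []       p≤ _ _ _ = trans (cong (_+ p) (downs-replicate-D (suc n ∸ p))) (m∸n+n≡m p≤)
downs-encode n p (a ∷ as) p≤ l (p≤a ∷ _) (a≤n ∷ as≤n) = begin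
  downs (replicate (a ∸ p) D ++ U ∷ encode n a as) + p ≡⟨ cong (_+ p) (downs-++ (replicate (a ∸ p) D) _) ⟩
  downs (replicate (a ∸ p) D) + d + p                   ≡⟨ cong (λ x → x + d + p) (downs-replicate-D (a ∸ p)) ⟩
  (a ∸ p) + d + p                                       ≡⟨ shuffle (a ∸ p) d p ⟩
  d + ((a ∸ p) + p)                                     ≡⟨ cong (d +_) (m∸n+n≡m p≤a) ⟩
  d + a
    ≡⟨ downs-encode n a as (m≤n⇒m≤1+n a≤n) (Linked.tail l) (Linked-≤-head l) as≤n ⟩
  suc n                                                 ∎
  where
  open ≡-Reasoning
  d = downs (encode n a as)
  shuffle : ∀ x y z → x + y + z ≡ y + (x + z)
  shuffle = solve-∀

encode-ends-with-D : ∀ n p α → p ≤ n → All (_≤ n) α → ∃ λ X → encode n p α ≡ X ++ D ∷ []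
encode-ends-with-D n p [] p≤n _ with suc n ∸ p | m>n⇒m∸n≢0 (s≤s p≤n)
... | zero  | ≢0 = ⊥-elim (≢0 refl)
... | suc m | _  = replicate m D , sym (trans (replicate-++-∷ m D []) (cong (D ∷_) (++-identityʳ _)))
encode-ends-with-D n p (a ∷ as) _ (a≤n ∷ as≤n) with encode-ends-with-D n a as a≤n as≤n
... | X , eq = replicate (a ∸ p) D ++ U ∷ X ,
  trans (cong (λ z → replicate (a ∸ p) D ++ U ∷ z) eq) (sym (++-assoc (replicate (a ∸ p) D) (U ∷ X) (D ∷ [])))

length-decode : ∀ p s → length (decode p s) ≡ ups s
length-decode p []      = refl
length-decode p (U ∷ s) = cong suc (length-decode p s)
length-decode p (D ∷ s) = length-decode (suc p) s

decode-≥ : ∀ p s → All (p ≤_) (decode p s)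
decode-≥ p []      = []
decode-≥ p (U ∷ s) = ≤-refl ∷ decode-≥ p s
decode-≥ p (D ∷ s) = All.map <⇒≤ (decode-≥ (suc p) s)

decode-≤ : ∀ p s → All (_≤ p + downs s) (decode p s)
decode-≤ p []      = []
decode-≤ p (U ∷ s) = m≤m+n p (downs s) ∷ decode-≤ p s
decode-≤ p (D ∷ s) = subst (λ z → All (_≤ z) (decode (suc p) s)) (sym (+-suc p (downs s))) (decode-≤ (suc p) s)

decode-ascending : ∀ p s → Linked _≤_ (decode p s)
decode-ascending p []      = []
decode-ascending p (U ∷ s) = Linked-≤-∷ (decode-≥ p s) (decode-ascending p s)
decode-ascending p (D ∷ s) = decode-ascending (suc p) s

-- The parking machine

-- The parking lot while cars with preferences ≥ cursor are still to come:
-- the spots cursor, …, cursor + block ∸ 1 are occupied, the spots in holes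
-- (strictly decreasing) are the empty spots below the cursor, every other spot
-- below the cursor is occupied and every other spot above it is empty.
record State : Set where
  constructor st
  field
    cursor block : ℕ
    holes        : List ℕ
open State

advance : State → State
advance (st a (suc r) F) = st (suc a) r F
advance (st a zero    F) = st (suc a) zero (a ∷ F)

advanceBy : State → ℕ → State
advanceBy s zero    = s
advanceBy s (suc m) = advanceBy (advance s) m

cursor-advanceBy : ∀ s m → cursor (advanceBy s m) ≡ cursor s + m
cursor-advanceBy s                zero    = sym (+-identityʳ (cursor s))
cursor-advanceBy (st a zero    F) (suc m) = trans (cursor-advanceBy _ m) (sym (+-suc a m))
cursor-advanceBy (st a (suc r) F) (suc m) = trans (cursor-advanceBy _ m) (sym (+-suc a m))

initial : State
initial = st 1 0 []

OutOfReach : ℕ → ℕ → List ℕ → Set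
OutOfReach k a []      = ⊤
OutOfReach k a (t ∷ F) = t + k < a

module Machine (k n : ℕ) where

  parkAhead : ℕ → ℕ → List ℕ → Maybe State
  parkAhead a r F with a + r ≤? n
  ... | yes _ = just (st a (suc r) F)
  ... | no  _ = nothing

  arrive : State → Maybe State
  arrive (st a zero F) with a ≤? n
  ... | yes _ = just (st a 1 F)
  ... | no  _ = nothing
  arrive (st a (suc r) [])      = parkAhead a (suc r) []
  arrive (st a (suc r) (t ∷ F)) with a ≤? t + k
  ... | yes _ = just (st a (suc r) F)
  ... | no  _ = parkAhead a (suc r) (t ∷ F)

  step : State → Step → Maybe State
  step s D = just (advance s)
  step s U = arrive s

  data Run : State → List Step → State → Set where
    []  : ∀ {s} → Run s [] s
    _∷_ : ∀ {s x xs s' e} → step s x ≡ just s' → Run s' xs e → Run s (x ∷ xs) e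

  Runs : State → List Step → Set
  Runs s t = ∃ (Run s t)

  Runs-∷ : ∀ {s x s' t} → step s x ≡ just s' → Runs s' t → Runs s (x ∷ t)
  Runs-∷ eq (e , r) = e , eq ∷ r

  Run-++ : ∀ {s m e xs ys} → Run s xs m → Run m ys e → Run s (xs ++ ys) e
  Run-++ []         r₂ = r₂
  Run-++ (eq ∷ r₁) r₂ = eq ∷ Run-++ r₁ r₂

  Run-++⁻ : ∀ {s e} xs {ys} → Run s (xs ++ ys) e → ∃ λ m → Run s xs m × Run m ys e
  Run-++⁻ []       r        = _ , [] , r
  Run-++⁻ (x ∷ xs) (eq ∷ r) with Run-++⁻ xs r
  ... | m , r₁ , r₂ = m , eq ∷ r₁ , r₂

  Run-advanceBy : ∀ s m → Run s (replicate m D) (advanceBy s m)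
  Run-advanceBy s zero    = []
  Run-advanceBy s (suc m) = refl ∷ Run-advanceBy (advance s) m

  Run-advanceBy⁻ : ∀ s m {e} → Run s (replicate m D) e → e ≡ advanceBy s m
  Run-advanceBy⁻ s zero    []         = refl
  Run-advanceBy⁻ s (suc m) (refl ∷ r) = Run-advanceBy⁻ (advance s) m r

  data Arrival : State → State → Set where
    atCursor : ∀ {a F}     → a ≤ n → Arrival (st a zero F) (st a 1 F)
    behind   : ∀ {a r t F} → a ≤ t + k → Arrival (st a (suc r) (t ∷ F)) (st a (suc r) F)
    ahead    : ∀ {a r F}   → OutOfReach k a F → a + suc r ≤ n →
               Arrival (st a (suc r) F) (st a (suc (suc r)) F)

  Arrival-cursor : ∀ {s s'} → Arrival s s' → cursor s' ≡ cursor s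
  Arrival-cursor (atCursor _) = refl
  Arrival-cursor (behind _)   = refl
  Arrival-cursor (ahead _ _)  = refl

  parkAhead-inv : ∀ a r F {s'} → OutOfReach k a F → parkAhead a (suc r) F ≡ just s' →
    Arrival (st a (suc r) F) s'
  parkAhead-inv a r F out eq with a + suc r ≤? n
  parkAhead-inv a r F out refl | yes a+r<n = ahead out a+r<n
  parkAhead-inv a r F out ()   | no  _

  arrive-inv : ∀ s {s'} → arrive s ≡ just s' → Arrival s s'
  arrive-inv (st a zero F) eq with a ≤? n
  arrive-inv (st a zero F) refl | yes a≤n = atCursor a≤n
  arrive-inv (st a zero F) ()   | no  _
  arrive-inv (st a (suc r) []) eq = parkAhead-inv a r [] _ eq
  arrive-inv (st a (suc r) (t ∷ F)) eq with a ≤? t + k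
  arrive-inv (st a (suc r) (t ∷ F)) refl | yes a≤t+k = behind a≤t+k
  ...                                     | no  a≰t+k = parkAhead-inv a r (t ∷ F) (≰⇒> a≰t+k) eq

  Arrival⇒arrive : ∀ {s s'} → Arrival s s' → arrive s ≡ just s'
  Arrival⇒arrive (atCursor {a} a≤n) with a ≤? n
  ... | yes _   = refl
  ... | no  a≰n = ⊥-elim (a≰n a≤n)
  Arrival⇒arrive (behind {a} {t = t} a≤t+k) with a ≤? t + k
  ... | yes _     = refl
  ... | no  a≰t+k = ⊥-elim (a≰t+k a≤t+k)
  Arrival⇒arrive (ahead {a} {r} {[]} _ a+r<n) = parkAhead-ahead a+r<n
    where
    parkAhead-ahead : a + suc r ≤ n → parkAhead a (suc r) [] ≡ just (st a (suc (suc r)) [])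
    parkAhead-ahead a+r<n with a + suc r ≤? n
    ... | yes _ = refl
    ... | no  ≰ = ⊥-elim (≰ a+r<n)
  Arrival⇒arrive (ahead {a} {r} {t ∷ F} t+k<a a+r<n) with a ≤? t + k
  ... | yes a≤t+k = ⊥-elim (<⇒≱ t+k<a a≤t+k)
  ... | no  _ with a + suc r ≤? n
  ...   | yes _ = refl
  ...   | no  ≰ = ⊥-elim (≰ a+r<n)

  WellFormed : State → Set
  WellFormed (st a r F) =
    Linked _>_ F × All (λ x → 1 ≤ x × x < a) F × (r ≡ 0 ⊎ a + r ≤ suc n) × 1 ≤ a

  initial-wf : WellFormed initial
  initial-wf = [] , [] , inj₁ refl , s≤s z≤n

  advance-wf : ∀ s → WellFormed s → WellFormed (advance s)
  advance-wf (st a zero F) (l , F<a , _ , 1≤a) =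
    Linked->-∷ (All.map proj₂ F<a) l , (1≤a , ≤-refl) ∷ All.map (λ (p , q) → p , m≤n⇒m≤1+n q) F<a ,
    inj₁ refl , s≤s z≤n
  advance-wf (st a (suc r) F) (_ , _ , inj₁ () , _)
  advance-wf (st a (suc r) F) (l , F<a , inj₂ a+r≤ , _) =
    l , All.map (λ (p , q) → p , m≤n⇒m≤1+n q) F<a , inj₂ (≤-trans (≤-reflexive (sym (+-suc a r))) a+r≤) , s≤s z≤n

  Arrival-wf : ∀ {s s'} → Arrival s s' → WellFormed s → WellFormed s'
  Arrival-wf (atCursor {a} a≤n) (l , F<a , _ , 1≤a) = l , F<a , inj₂ (≤-trans (≤-reflexive (+-comm a 1)) (s≤s a≤n)) , 1≤a
  Arrival-wf (behind _) (l , _ ∷ F<a , r≤ , 1≤a) = Linked.tail l , F<a , r≤ , 1≤a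
  Arrival-wf (ahead {a} {r} _ a+r<n) (l , F<a , _ , 1≤a) =
    l , F<a , inj₂ (≤-trans (≤-reflexive (+-suc a (suc r))) (s≤s a+r<n)) , 1≤a

  step-wf : ∀ s x {s'} → step s x ≡ just s' → WellFormed s → WellFormed s'
  step-wf s D refl = advance-wf s
  step-wf s U eq   = Arrival-wf (arrive-inv s eq)

  Run-wf : ∀ {s t e} → Run s t e → WellFormed s → WellFormed e
  Run-wf []                 wf = wf
  Run-wf (_∷_ {x = x} eq r) wf = Run-wf r (step-wf _ x eq wf)

-- The machine follows the Naples rule

elem⇒∈ : ∀ x occ → elem x occ ≡ true → x ∈ occ
elem⇒∈ x (y ∷ ys) eq with x ≡ᵇ y in x≡ᵇy
... | true  = here (≡ᵇ⇒≡ x y (subst T (sym x≡ᵇy) _))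
... | false = there (elem⇒∈ x ys eq)

∈⇒elem : ∀ x occ → x ∈ occ → elem x occ ≡ true
∈⇒elem x (y ∷ ys) (here refl) with x ≡ᵇ x in x≡ᵇx
... | true  = refl
... | false = ⊥-elim (subst T x≡ᵇx (≡⇒≡ᵇ x x refl))
∈⇒elem x (y ∷ ys) (there x∈ys) with x ≡ᵇ y
... | true  = refl
... | false = ∈⇒elem x ys x∈ys

firstFree-free : ∀ occ x L → elem x occ ≡ false → firstFree occ (x ∷ L) ≡ just x
firstFree-free occ x L eq rewrite eq = refl

firstFree-taken : ∀ occ x L → elem x occ ≡ true → firstFree occ (x ∷ L) ≡ firstFree occ L
firstFree-taken occ x L eq rewrite eq = refl

applyUpTo-cong : ∀ {f g : ℕ → ℕ} m → (∀ i → f i ≡ g i) → applyUpTo f m ≡ applyUpTo g m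
applyUpTo-cong zero    f≗g = refl
applyUpTo-cong (suc m) f≗g = cong₂ _∷_ (f≗g 0) (applyUpTo-cong m (λ i → f≗g (suc i)))

spotsBelow : ℕ → ℕ → List ℕ
spotsBelow a zero    = []
spotsBelow a (suc k) = pred a ∷ spotsBelow (pred a) k

spotsAbove : ℕ → ℕ → List ℕ
spotsAbove a zero    = []
spotsAbove a (suc m) = suc a ∷ spotsAbove (suc a) m

positive : ℕ → Bool
positive s = 0 <ᵇ s

backCands≡ : ∀ k a → backCands k a ≡ filterᵇ positive (spotsBelow a k)
backCands≡ k a = cong (filterᵇ positive) (applyUpTo≡spotsBelow a k)
  where
  ∸-suc-suc : ∀ a i → a ∸ suc (suc i) ≡ pred a ∸ suc i
  ∸-suc-suc zero    i = refl
  ∸-suc-suc (suc a) i = refl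
  applyUpTo≡spotsBelow : ∀ a k → applyUpTo (λ i → a ∸ suc i) k ≡ spotsBelow a k
  applyUpTo≡spotsBelow a zero    = refl
  applyUpTo≡spotsBelow a (suc k) = cong₂ _∷_ (sym (pred[m∸n]≡m∸[1+n] a 0))
    (trans (applyUpTo-cong k (∸-suc-suc a)) (applyUpTo≡spotsBelow (pred a) k))

fwdCands≡ : ∀ n a → fwdCands n a ≡ spotsAbove a (n ∸ a)
fwdCands≡ n a = applyUpTo≡spotsAbove a (n ∸ a)
  where
  applyUpTo≡spotsAbove : ∀ a m → applyUpTo (λ i → a + suc i) m ≡ spotsAbove a m
  applyUpTo≡spotsAbove a zero    = refl
  applyUpTo≡spotsAbove a (suc m) = cong₂ _∷_ (+-comm a 1)
    (trans (applyUpTo-cong m (λ i → +-suc a (suc i))) (applyUpTo≡spotsAbove (suc a) m))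

firstFree-below-taken : ∀ occ k a ys → (∀ y → 1 ≤ y → y < a → a ≤ y + k → elem y occ ≡ true) →
  firstFree occ (filterᵇ positive (spotsBelow a k) ++ ys) ≡ firstFree occ ys
firstFree-below-taken occ zero    a               ys taken = refl
firstFree-below-taken occ (suc k) zero            ys taken = firstFree-below-taken occ k zero ys (λ _ _ ())
firstFree-below-taken occ (suc k) (suc zero)      ys taken = firstFree-below-taken occ k zero ys (λ _ _ ())
firstFree-below-taken occ (suc k) (suc (suc a)) ys taken =
  trans (firstFree-taken occ (suc a) (filterᵇ positive (spotsBelow (suc a) k) ++ ys) (taken (suc a) (s≤s z≤n) ≤-refl in-reach))
    (firstFree-below-taken occ k (suc a) ys
      (λ y 1≤y y<a a≤ → taken y 1≤y (m≤n⇒m≤1+n y<a) (≤-trans (s≤s a≤) (≤-reflexive (sym (+-suc y k))))))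
  where
  in-reach : suc (suc a) ≤ suc a + suc k
  in-reach = ≤-trans (s≤s (s≤s (m≤m+n a k))) (≤-reflexive (sym (+-suc (suc a) k)))

firstFree-below-hole : ∀ occ k a t ys → t < a → a ≤ t + k → 1 ≤ t → elem t occ ≡ false →
  (∀ y → t < y → y < a → elem y occ ≡ true) →
  firstFree occ (filterᵇ positive (spotsBelow a k) ++ ys) ≡ just t
firstFree-below-hole occ zero a t ys t<a a≤t+k _ _ _ = ⊥-elim (<⇒≱ t<a (≤-trans a≤t+k (≤-reflexive (+-identityʳ t))))
firstFree-below-hole occ (suc k) (suc a) t ys t<a a≤ 1≤t free taken with t ≟ a
firstFree-below-hole occ (suc k) (suc a) t ys t<a a≤ (s≤s _) free taken | yes refl =
  firstFree-free occ t (filterᵇ positive (spotsBelow t k) ++ ys) free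
firstFree-below-hole occ (suc k) (suc zero) t ys (s≤s z≤n) a≤ () free taken | no _
firstFree-below-hole occ (suc k) (suc (suc a)) t ys t<a a≤ 1≤t free taken | no t≢a =
  trans (firstFree-taken occ (suc a) (filterᵇ positive (spotsBelow (suc a) k) ++ ys) (taken (suc a) t<a' ≤-refl))
    (firstFree-below-hole occ k (suc a) t ys t<a' (s≤s⁻¹ (≤-trans a≤ (≤-reflexive (+-suc t k)))) 1≤t free
      (λ y t<y y<a → taken y t<y (m≤n⇒m≤1+n y<a)))
  where
  t<a' : t < suc a
  t<a' = ≤∧≢⇒< (s≤s⁻¹ t<a) t≢a

firstFree-above : ∀ occ a m t → a < t → t ≤ a + m → elem t occ ≡ false →
  (∀ y → a < y → y < t → elem y occ ≡ true) → firstFree occ (spotsAbove a m) ≡ just t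
firstFree-above occ a zero t a<t t≤ _ _ = ⊥-elim (<⇒≱ a<t (≤-trans t≤ (≤-reflexive (+-identityʳ a))))
firstFree-above occ a (suc m) t a<t t≤ free taken with t ≟ suc a
... | yes refl = firstFree-free occ (suc a) (spotsAbove (suc a) m) free
... | no  t≢a  =
  trans (firstFree-taken occ (suc a) (spotsAbove (suc a) m) (taken (suc a) ≤-refl a<t'))
    (firstFree-above occ (suc a) m t a<t' (≤-trans t≤ (≤-reflexive (+-suc a m))) free
      (λ y a<y y<t → taken y (<-trans (n<1+n a) a<y) y<t))
  where
  a<t' : suc a < t
  a<t' = ≤∧≢⇒< a<t (λ e → t≢a (sym e))

firstFree-above-full : ∀ occ a m → (∀ y → a < y → y ≤ a + m → elem y occ ≡ true) →
  firstFree occ (spotsAbove a m) ≡ nothing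
firstFree-above-full occ a zero    taken = refl
firstFree-above-full occ a (suc m) taken =
  trans (firstFree-taken occ (suc a) (spotsAbove (suc a) m) (taken (suc a) ≤-refl (≤-trans (s≤s (m≤m+n a m)) a+m<)))
    (firstFree-above-full occ (suc a) m (λ y a<y y≤ → taken y (<-trans (n<1+n a) a<y) (≤-trans y≤ a+m<)))
  where
  a+m< : suc (a + m) ≤ a + suc m
  a+m< = ≤-reflexive (sym (+-suc a m))

∉-∷ : ∀ {x t} {F : List ℕ} → x ≢ t → ¬ (x ∈ F) → ¬ (x ∈ t ∷ F)
∉-∷ x≢t x∉F (here x≡t)  = x≢t x≡t
∉-∷ x≢t x∉F (there x∈F) = x∉F x∈F

∉-above : ∀ {x t F} → All (_< t) F → t ≤ x → ¬ (x ∈ F)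
∉-above F<t t≤x x∈F = <⇒≱ (All.lookup F<t x∈F) t≤x

Occupied : State → ℕ → Set
Occupied (st a r F) x = (1 ≤ x × x < a × ¬ (x ∈ F)) ⊎ (a ≤ x × x < a + r)

Represents : List ℕ → State → Set
Represents occ s = ∀ x → (x ∈ occ → Occupied s x) × (Occupied s x → x ∈ occ)

Represents-occupied : ∀ {occ s x} → Represents occ s → Occupied s x → elem x occ ≡ true
Represents-occupied {occ} {x = x} R o = ∈⇒elem x occ (proj₂ (R x) o)

Represents-free : ∀ {occ s x} → Represents occ s → ¬ Occupied s x → elem x occ ≡ false
Represents-free {occ} {x = x} R free with elem x occ in e
... | false = refl
... | true  = ⊥-elim (free (proj₁ (R x) (elem⇒∈ x occ e)))

Represents-initial : Represents [] initial
Represents-initial x = (λ ()) , λ { (inj₁ (1≤x , x<1 , _)) → ⊥-elim (<⇒≱ x<1 1≤x)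
                                  ; (inj₂ (1≤x , x<1))     → ⊥-elim (<⇒≱ x<1 1≤x) }

Adds : State → ℕ → State → Set
Adds s t s' = ∀ x → (Occupied s' x → x ≡ t ⊎ Occupied s x) × (x ≡ t ⊎ Occupied s x → Occupied s' x)

Represents-∷ : ∀ {occ s t s'} → Adds s t s' → Represents occ s → Represents (t ∷ occ) s'
Represents-∷ adds R x = to , from
  where
  to : x ∈ _ → Occupied _ x
  to (here x≡t) = proj₂ (adds x) (inj₁ x≡t)
  to (there x∈) = proj₂ (adds x) (inj₂ (proj₁ (R x) x∈))
  from : Occupied _ x → x ∈ _
  from o with proj₁ (adds x) o
  ... | inj₁ x≡t = here x≡t
  ... | inj₂ o'  = there (proj₂ (R x) o')

Adds-atCursor : ∀ a F → Adds (st a 0 F) a (st a 1 F)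
Adds-atCursor a F x = to , from
  where
  to : Occupied (st a 1 F) x → x ≡ a ⊎ Occupied (st a 0 F) x
  to (inj₁ o)           = inj₂ (inj₁ o)
  to (inj₂ (a≤x , x<)) = inj₁ (≤-antisym (s≤s⁻¹ (≤-trans x< (≤-reflexive (+-comm a 1)))) a≤x)
  from : x ≡ a ⊎ Occupied (st a 0 F) x → Occupied (st a 1 F) x
  from (inj₁ refl)             = inj₂ (≤-refl , ≤-reflexive (+-comm 1 x))
  from (inj₂ (inj₁ o))         = inj₁ o
  from (inj₂ (inj₂ (a≤x , x<))) = ⊥-elim (<⇒≱ x< (≤-trans (≤-reflexive (+-identityʳ a)) a≤x))

Adds-behind : ∀ {a r t F} → 1 ≤ t → t < a → ¬ (t ∈ F) → Adds (st a (suc r) (t ∷ F)) t (st a (suc r) F)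
Adds-behind {a} {r} {t} {F} 1≤t t<a t∉F x = to , from
  where
  to : Occupied (st a (suc r) F) x → x ≡ t ⊎ Occupied (st a (suc r) (t ∷ F)) x
  to (inj₁ (1≤x , x<a , x∉F)) with x ≟ t
  ... | yes x≡t = inj₁ x≡t
  ... | no  x≢t = inj₂ (inj₁ (1≤x , x<a , ∉-∷ x≢t x∉F))
  to (inj₂ o) = inj₂ (inj₂ o)
  from : x ≡ t ⊎ Occupied (st a (suc r) (t ∷ F)) x → Occupied (st a (suc r) F) x
  from (inj₁ refl)                   = inj₁ (1≤t , t<a , t∉F)
  from (inj₂ (inj₁ (1≤x , x<a , x∉))) = inj₁ (1≤x , x<a , λ x∈F → x∉ (there x∈F))
  from (inj₂ (inj₂ o))               = inj₂ o

Adds-ahead : ∀ a r F → Adds (st a (suc r) F) (a + suc r) (st a (suc (suc r)) F)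
Adds-ahead a r F x = to , from
  where
  to : Occupied (st a (suc (suc r)) F) x → x ≡ a + suc r ⊎ Occupied (st a (suc r) F) x
  to (inj₁ o) = inj₂ (inj₁ o)
  to (inj₂ (a≤x , x<)) with x ≟ a + suc r
  ... | yes x≡ = inj₁ x≡
  ... | no  x≢ = inj₂ (inj₂ (a≤x , ≤∧≢⇒< (s≤s⁻¹ (≤-trans x< (≤-reflexive (+-suc a (suc r))))) x≢))
  from : x ≡ a + suc r ⊎ Occupied (st a (suc r) F) x → Occupied (st a (suc (suc r)) F) x
  from (inj₁ refl)             = inj₂ (m≤m+n a (suc r) , ≤-reflexive (sym (+-suc a (suc r))))
  from (inj₂ (inj₁ o))         = inj₁ o
  from (inj₂ (inj₂ (a≤x , x<))) = inj₂ (a≤x , ≤-trans x< (≤-trans (n≤1+n _) (≤-reflexive (sym (+-suc a (suc r))))))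

module Simulation (k n : ℕ) where
  open Machine k n

  Occupied-advance : ∀ s → WellFormed s → ∀ x →
    (Occupied s x → Occupied (advance s) x) × (Occupied (advance s) x → Occupied s x)
  Occupied-advance (st a zero F) _ x = to , from
    where
    to : Occupied (st a zero F) x → Occupied (advance (st a zero F)) x
    to (inj₁ (1≤x , x<a , x∉F)) = inj₁ (1≤x , m≤n⇒m≤1+n x<a , ∉-∷ (λ x≡a → <-irrefl x≡a x<a) x∉F)
    to (inj₂ (a≤x , x<))        = ⊥-elim (<⇒≱ x< (≤-trans (≤-reflexive (+-identityʳ a)) a≤x))
    from : Occupied (advance (st a zero F)) x → Occupied (st a zero F) x
    from (inj₁ (1≤x , x≤a , x∉)) with x ≟ a
    ... | yes x≡a = ⊥-elim (x∉ (here x≡a))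
    ... | no  x≢a = inj₁ (1≤x , ≤∧≢⇒< (s≤s⁻¹ x≤a) x≢a , λ x∈F → x∉ (there x∈F))
    from (inj₂ (a<x , x<))     = ⊥-elim (<⇒≱ x< (≤-trans (≤-reflexive (+-identityʳ (suc a))) a<x))
  Occupied-advance (st a (suc r) F) (_ , F<a , _ , 1≤a) x = to , from
    where
    to : Occupied (st a (suc r) F) x → Occupied (advance (st a (suc r) F)) x
    to (inj₁ (1≤x , x<a , x∉F)) = inj₁ (1≤x , m≤n⇒m≤1+n x<a , x∉F)
    to (inj₂ (a≤x , x<)) with x ≟ a
    ... | yes refl = inj₁ (1≤a , ≤-refl , λ a∈F → <-irrefl refl (proj₂ (All.lookup F<a a∈F)))
    ... | no  x≢a  = inj₂ (≤∧≢⇒< a≤x (λ a≡x → x≢a (sym a≡x)) , ≤-trans x< (≤-reflexive (+-suc a r)))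
    from : Occupied (advance (st a (suc r) F)) x → Occupied (st a (suc r) F) x
    from (inj₁ (1≤x , x≤a , x∉F)) with x ≟ a
    ... | yes refl = inj₂ (≤-refl , ≤-trans (s≤s (m≤m+n x r)) (≤-reflexive (sym (+-suc x r))))
    ... | no  x≢a  = inj₁ (1≤x , ≤∧≢⇒< (s≤s⁻¹ x≤a) x≢a , x∉F)
    from (inj₂ (a<x , x<)) = inj₂ (<⇒≤ a<x , ≤-trans x< (≤-reflexive (sym (+-suc a r))))

  Represents-advance : ∀ {occ s} → WellFormed s → Represents occ s → Represents occ (advance s)
  Represents-advance {s = s} wf R x =
    (λ x∈ → proj₁ (Occupied-advance s wf x) (proj₁ (R x) x∈)) ,
    (λ o → proj₂ (R x) (proj₂ (Occupied-advance s wf x) o))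

  advanceBy-wf : ∀ s m → WellFormed s → WellFormed (advanceBy s m)
  advanceBy-wf s zero    wf = wf
  advanceBy-wf s (suc m) wf = advanceBy-wf (advance s) m (advance-wf s wf)

  Represents-advanceBy : ∀ {occ} s m → WellFormed s → Represents occ s → Represents occ (advanceBy s m)
  Represents-advanceBy s zero    wf R = R
  Represents-advanceBy s (suc m) wf R = Represents-advanceBy (advance s) m (advance-wf s wf) (Represents-advance wf R)

  candidates : ℕ → List ℕ
  candidates a = filterᵇ positive (spotsBelow a k) ++ spotsAbove a (n ∸ a)

  naplesSpot≡ : ∀ occ a → naplesSpot k n occ a ≡ firstFree occ (a ∷ candidates a)
  naplesSpot≡ occ a = cong₂ (λ L M → firstFree occ (a ∷ L ++ M)) (backCands≡ k a) (fwdCands≡ n a)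

  Agree : List ℕ → Maybe ℕ → Maybe State → Set
  Agree occ nothing  nothing   = ⊤
  Agree occ (just t) (just s') = Represents (t ∷ occ) s'
  Agree occ _        _         = ⊥

  Agree-via : ∀ {occ m m' ms} → m ≡ m' → Agree occ m' ms → Agree occ m ms
  Agree-via refl agree = agree

  parkAhead-agrees : ∀ {occ a r F} → Represents occ (st a (suc r) F) → a ≤ n →
    Agree occ (firstFree occ (spotsAbove a (n ∸ a))) (parkAhead a (suc r) F)
  parkAhead-agrees {occ} {a} {r} {F} R a≤n with a + suc r ≤? n
  ... | yes a+r<n = Agree-via parks-at-block-end (Represents-∷ (Adds-ahead a r F) R)
    where
    block-end-free : ¬ Occupied (st a (suc r) F) (a + suc r)
    block-end-free (inj₁ (_ , x<a , _)) = <⇒≱ x<a (m≤m+n a (suc r))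
    block-end-free (inj₂ (_ , x<x))     = <-irrefl refl x<x
    parks-at-block-end : firstFree occ (spotsAbove a (n ∸ a)) ≡ just (a + suc r)
    parks-at-block-end = firstFree-above occ a (n ∸ a) (a + suc r)
      (≤-trans (s≤s (m≤m+n a r)) (≤-reflexive (sym (+-suc a r))))
      (≤-trans a+r<n (≤-reflexive (sym (m+[n∸m]≡n a≤n))))
      (Represents-free R block-end-free) (λ y a<y y< → Represents-occupied R (inj₂ (<⇒≤ a<y , y<)))
  ... | no a+r≮n = Agree-via (firstFree-above-full occ a (n ∸ a) all-taken) tt
    where
    all-taken : ∀ y → a < y → y ≤ a + (n ∸ a) → elem y occ ≡ true
    all-taken y a<y y≤ = Represents-occupied R (inj₂ (<⇒≤ a<y ,
      ≤-<-trans (≤-trans y≤ (≤-reflexive (m+[n∸m]≡n a≤n))) (≰⇒> a+r≮n)))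

  naplesSpot-block : ∀ {occ a r F} → Represents occ (st a (suc r) F) →
    naplesSpot k n occ a ≡ firstFree occ (candidates a)
  naplesSpot-block {occ} {a} {r} R =
    trans (naplesSpot≡ occ a) (firstFree-taken occ a (candidates a) (Represents-occupied R (inj₂ (≤-refl , a<a+r+1))))
    where
    a<a+r+1 : a < a + suc r
    a<a+r+1 = ≤-trans (s≤s (m≤m+n a r)) (≤-reflexive (sym (+-suc a r)))

  arrive-agrees : ∀ {occ} s → WellFormed s → Represents occ s → cursor s ≤ n →
    Agree occ (naplesSpot k n occ (cursor s)) (arrive s)
  arrive-agrees {occ} (st a zero F) _ R a≤n with a ≤? n
  ... | no  a≰n = ⊥-elim (a≰n a≤n)
  ... | yes _   = Agree-via (trans (naplesSpot≡ occ a) (firstFree-free occ a (candidates a) (Represents-free R a-free)))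
                    (Represents-∷ (Adds-atCursor a F) R)
    where
    a-free : ¬ Occupied (st a zero F) a
    a-free (inj₁ (_ , a<a , _)) = <-irrefl refl a<a
    a-free (inj₂ (_ , a<a+0))   = <⇒≱ a<a+0 (≤-reflexive (+-identityʳ a))
  arrive-agrees {occ} (st a (suc r) []) _ R a≤n =
    Agree-via (trans (naplesSpot-block R) (firstFree-below-taken occ k a _ below-taken)) (parkAhead-agrees R a≤n)
    where
    below-taken : ∀ y → 1 ≤ y → y < a → a ≤ y + k → elem y occ ≡ true
    below-taken y 1≤y y<a _ = Represents-occupied R (inj₁ (1≤y , y<a , λ ()))
  arrive-agrees {occ} (st a (suc r) (t ∷ F)) (l , (1≤t , t<a) ∷ _ , _) R a≤n with a ≤? t + k
  ... | yes a≤t+k = Agree-via (trans (naplesSpot-block R) parks-at-t)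
                      (Represents-∷ (Adds-behind 1≤t t<a (∉-above (Linked->-head l) ≤-refl)) R)
    where
    t-free : ¬ Occupied (st a (suc r) (t ∷ F)) t
    t-free (inj₁ (_ , _ , t∉)) = t∉ (here refl)
    t-free (inj₂ (a≤t , _))    = <⇒≱ t<a a≤t
    parks-at-t : firstFree occ (candidates a) ≡ just t
    parks-at-t = firstFree-below-hole occ k a t _ t<a a≤t+k 1≤t (Represents-free R t-free)
      (λ y t<y y<a → Represents-occupied R (inj₁ (≤-trans 1≤t (<⇒≤ t<y) , y<a ,
         ∉-∷ (λ y≡t → <-irrefl (sym y≡t) t<y) (∉-above (Linked->-head l) (<⇒≤ t<y)))))
  ... | no a≰t+k = Agree-via (trans (naplesSpot-block R) (firstFree-below-taken occ k a _ below-taken))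
                     (parkAhead-agrees R a≤n)
    where
    below-taken : ∀ y → 1 ≤ y → y < a → a ≤ y + k → elem y occ ≡ true
    below-taken y 1≤y y<a a≤y+k = Represents-occupied R (inj₁ (1≤y , y<a ,
      ∉-∷ (λ y≡t → <-irrefl (sym y≡t) t<y) (∉-above (Linked->-head l) (<⇒≤ t<y))))
      where
      t<y : t < y
      t<y = +-cancelʳ-< k t y (<-≤-trans (≰⇒> a≰t+k) a≤y+k)

  Parks : List ℕ → List ℕ → Set
  Parks occ α = ∃ λ o → parkAll k n occ α ≡ just o

  Runs-advanceBy⇔ : ∀ s m t → Runs (advanceBy s m) t ⇔ Runs s (replicate m D ++ t)
  Runs-advanceBy⇔ s m t = mk⇔ (λ (e , r) → e , Run-++ (Run-advanceBy s m) r) from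
    where
    from : Runs s (replicate m D ++ t) → Runs (advanceBy s m) t
    from (e , r) with Run-++⁻ (replicate m D) r
    ... | _ , r₁ , r₂ rewrite Run-advanceBy⁻ s m r₁ = e , r₂

  Parks-∷⇔Runs-U : ∀ {occ x as s w} → Agree occ (naplesSpot k n occ x) (arrive s) →
    (∀ {t s'} → arrive s ≡ just s' → Represents (t ∷ occ) s' → Parks (t ∷ occ) as ⇔ Runs s' w) →
    Parks occ (x ∷ as) ⇔ Runs s (U ∷ w)
  Parks-∷⇔Runs-U {occ} {x} {as} {s} {w} agree IH with naplesSpot k n occ x | arrive s in eq | agree
  ... | nothing | nothing | _ = mk⇔ (λ ()) λ { (_ , e ∷ _) → case trans (sym e) eq of λ () }
  ... | just t  | just s' | R = mk⇔
    (λ parks → Runs-∷ eq (Equivalence.to (IH refl R) parks))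
    (λ { (e , e' ∷ r) → Equivalence.from (IH refl R) (e , subst (λ z → Run z w e) (just-injective (trans (sym e') eq)) r) })

  Parks⇔Runs : ∀ α p occ s → cursor s ≡ p → WellFormed s → Represents occ s →
    Linked _≤_ α → All (p ≤_) α → All (_≤ n) α → Parks occ α ⇔ Runs s (encode n p α)
  Parks⇔Runs [] p occ s _ _ _ _ _ _ = mk⇔ (λ _ → _ , Run-advanceBy s _) (λ _ → occ , refl)
  Parks⇔Runs (x ∷ as) p occ s refl wf R l (p≤x ∷ _) (x≤n ∷ as≤n) =
    Runs-advanceBy⇔ s (x ∸ p) _ ⇔-∘ Parks-∷⇔Runs-U agree IH
    where
    s₁ = advanceBy s (x ∸ p)
    wf₁ : WellFormed s₁
    wf₁ = advanceBy-wf s (x ∸ p) wf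
    s₁-at-x : cursor s₁ ≡ x
    s₁-at-x = trans (cursor-advanceBy s (x ∸ p)) (m+[n∸m]≡n p≤x)
    agree : Agree occ (naplesSpot k n occ x) (arrive s₁)
    agree = subst (λ a → Agree occ (naplesSpot k n occ a) (arrive s₁)) s₁-at-x
      (arrive-agrees s₁ wf₁ (Represents-advanceBy s (x ∸ p) wf R) (subst (_≤ n) (sym s₁-at-x) x≤n))
    IH : ∀ {t s'} → arrive s₁ ≡ just s' → Represents (t ∷ occ) s' → Parks (t ∷ occ) as ⇔ Runs s' (encode n x as)
    IH {t} {s'} eq R' = Parks⇔Runs as x (t ∷ occ) s' (trans (Arrival-cursor (arrive-inv s₁ eq)) s₁-at-x)
      (Arrival-wf (arrive-inv s₁ eq) wf₁) R' (Linked.tail l) (Linked-≤-head l) as≤n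

-- Window conditions

Rebound : ℕ → List Step → Set
Rebound k xs = ∃ λ j → 1 ≤ j × j ≤ 2 * k × j ≤ length xs × height (take j xs) ≡ pos 2

StaysNonneg : ℕ → List Step → Set
StaysNonneg h []           = ⊤
StaysNonneg h (U ∷ xs)     = StaysNonneg (suc h) xs
StaysNonneg zero (D ∷ xs)  = ⊥
StaysNonneg (suc h) (D ∷ xs) = StaysNonneg h xs

Rebounds : ℕ → ℕ → ℕ → List Step → Set
Rebounds k zero    h xs       = ⊤
Rebounds k (suc c) h []       = ⊤
Rebounds k (suc c) h (U ∷ xs) = Rebounds k c (suc h) xs
Rebounds k (suc c) h (D ∷ xs) = (h ≡ k → Rebound k xs) × Rebounds k c (pred h) xs

StaysNonneg-replicate-D : ∀ k h → k ≤ h → StaysNonneg h (replicate k D)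
StaysNonneg-replicate-D zero    h       _         = tt
StaysNonneg-replicate-D (suc k) (suc h) (s≤s k≤h) = StaysNonneg-replicate-D k h k≤h

length-decreasing : ∀ {lo hi F} → lo ≤ hi → Linked _>_ F → All (λ y → lo ≤ y × y < hi) F → length F + lo ≤ hi
length-decreasing lo≤hi []  []                 = lo≤hi
length-decreasing _     l   ((lo≤y , y<hi) ∷ G∈) =
  ≤-trans (s≤s (length-decreasing lo≤y (Linked.tail l) G∈′)) y<hi
  where
  G∈′ = All.zipWith (λ ((lo≤ , _) , <y) → lo≤ , <y) (G∈ , Linked->-head l)

Rebound-of-prefix : ∀ k t ys j → j ≤ length t → ups (take j t) ≡ downs (take j t) + 2 → suc (downs (take j t)) ≤ k →
  Rebound k (t ++ ys)
Rebound-of-prefix k t ys j j≤ rise d<k = j , 1≤j , j≤2k , j≤′ , height-2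
  where
  d = downs (take j t)
  j≡ : j ≡ suc d + suc d
  j≡ = begin
    j                        ≡⟨ length-take-≤ j t j≤ ⟨
    length (take j t)        ≡⟨ length≡ups+downs (take j t) ⟩
    ups (take j t) + d       ≡⟨ cong (_+ d) rise ⟩
    d + 2 + d                ≡⟨ shuffle d ⟩
    suc d + suc d            ∎
    where
    open ≡-Reasoning
    shuffle : ∀ d → d + 2 + d ≡ suc d + suc d
    shuffle = solve-∀
  1≤j : 1 ≤ j
  1≤j = subst (1 ≤_) (sym j≡) (s≤s z≤n)
  j≤2k : j ≤ 2 * k
  j≤2k = subst (_≤ 2 * k) (sym j≡) (≤-trans (+-mono-≤ d<k d<k) (≤-reflexive (cong (k +_) (sym (+-identityʳ k)))))
  j≤′ : j ≤ length (t ++ ys)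
  j≤′ = ≤-trans j≤ (≤-trans (m≤m+n (length t) _) (≤-reflexive (sym (length-++ t))))
  height-2 : height (take j (t ++ ys)) ≡ pos 2
  height-2 = trans (cong height (take-++-≤ j t ys j≤))
    (trans (height≡ups⊖downs (take j t)) (≡+⇒⊖≡+ _ d 2 rise))

Rebound⇒prefix : ∀ k xs → Rebound k xs →
  ∃ λ j → j ≤ length xs × ups (take j xs) ≡ downs (take j xs) + 2 × suc (downs (take j xs)) ≤ k
Rebound⇒prefix k xs (j , _ , j≤2k , j≤ , height-2) = j , j≤ , rise , d<k
  where
  u = ups (take j xs)
  d = downs (take j xs)
  rise : u ≡ d + 2
  rise = ⊖≡+⇒≡+ u d 2 (trans (sym (height≡ups⊖downs (take j xs))) height-2)
  2[1+d]≤2k : suc d + suc d ≤ k + k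
  2[1+d]≤2k = begin
    suc d + suc d     ≡⟨ shuffle d ⟨
    d + 2 + d         ≡⟨ cong (_+ d) rise ⟨
    u + d             ≡⟨ length≡ups+downs (take j xs) ⟨
    length (take j xs) ≡⟨ length-take-≤ j xs j≤ ⟩
    j                 ≤⟨ j≤2k ⟩
    k + (k + 0)       ≡⟨ cong (k +_) (+-identityʳ k) ⟩
    k + k             ∎
    where
    open ≤-Reasoning
    shuffle : ∀ d → d + 2 + d ≡ suc d + suc d
    shuffle = solve-∀
  d<k : suc d ≤ k
  d<k with suc d ≤? k
  ... | yes d<k = d<k
  ... | no  d≮k = ⊥-elim (<⇒≱ (+-mono-< (≰⇒> d≮k) (≰⇒> d≮k)) 2[1+d]≤2k)

StaysNonneg⇒prefixes : ∀ h xs → StaysNonneg h xs → ∀ i → downs (take i xs) ≤ h + ups (take i xs)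
StaysNonneg⇒prefixes h       xs       _  zero    = z≤n
StaysNonneg⇒prefixes h       []       _  (suc i) = z≤n
StaysNonneg⇒prefixes h       (U ∷ xs) nn (suc i) = ≤-trans (StaysNonneg⇒prefixes (suc h) xs nn i) (≤-reflexive (sym (+-suc h _)))
StaysNonneg⇒prefixes (suc h) (D ∷ xs) nn (suc i) = s≤s (StaysNonneg⇒prefixes h xs nn i)

prefixes⇒StaysNonneg : ∀ h xs → (∀ i → downs (take i xs) ≤ h + ups (take i xs)) → StaysNonneg h xs
prefixes⇒StaysNonneg h       []       _   = tt
prefixes⇒StaysNonneg h       (U ∷ xs) ok =
  prefixes⇒StaysNonneg (suc h) xs (λ i → ≤-trans (ok (suc i)) (≤-reflexive (+-suc h _)))
prefixes⇒StaysNonneg zero    (D ∷ xs) ok with ok 1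
... | ()
prefixes⇒StaysNonneg (suc h) (D ∷ xs) ok = prefixes⇒StaysNonneg h xs (λ i → s≤s⁻¹ (ok (suc i)))

StaysNonneg-U^ : ∀ h m X → StaysNonneg h (replicate m U ++ X) ≡ StaysNonneg (h + m) X
StaysNonneg-U^ h zero    X = cong (λ z → StaysNonneg z X) (sym (+-identityʳ h))
StaysNonneg-U^ h (suc m) X = trans (StaysNonneg-U^ (suc h) m X) (cong (λ z → StaysNonneg z X) (sym (+-suc h m)))

Rebounds-U^ : ∀ k h m c X → Rebounds k (m + c) h (replicate m U ++ X) ≡ Rebounds k c (h + m) X
Rebounds-U^ k h zero    c X = cong (λ z → Rebounds k c z X) (sym (+-identityʳ h))
Rebounds-U^ k h (suc m) c X = trans (Rebounds-U^ k (suc h) m c X) (cong (λ z → Rebounds k c z X) (sym (+-suc h m)))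

Rebounds-≤ : ∀ k {c c′} h xs → c′ ≤ c → Rebounds k c h xs → Rebounds k c′ h xs
Rebounds-≤ k {c} {zero}    h xs       _          _   = tt
Rebounds-≤ k {suc c} {suc c′} h [] _ _ = tt
Rebounds-≤ k {suc c} {suc c′} h (U ∷ xs) (s≤s c′≤c) rbs = Rebounds-≤ k (suc h) xs c′≤c rbs
Rebounds-≤ k {suc c} {suc c′} h (D ∷ xs) (s≤s c′≤c) (crossing , rbs) = crossing , Rebounds-≤ k (pred h) xs c′≤c rbs

Window : ℕ → ℕ → ℕ → List Step → Set
Window k c h xs = ∀ i rest → i < c → drop i xs ≡ D ∷ rest →
  h + ups (take i xs) ≡ k + downs (take i xs) → Rebound k rest

Rebounds⇒Window : ∀ k c h xs → Rebounds k c h xs → StaysNonneg h xs → Window k c h xs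
Rebounds⇒Window k (suc c) h       (U ∷ xs) rbs nn zero    rest _         ()
Rebounds⇒Window k (suc c) h       (U ∷ xs) rbs nn (suc i) rest (s≤s i<c) dropped at-k =
  Rebounds⇒Window k c (suc h) xs rbs nn i rest i<c dropped (trans (sym (+-suc h _)) at-k)
Rebounds⇒Window k (suc c) h       (D ∷ xs) (crossing , _) nn zero rest _ refl at-k =
  crossing (trans (sym (+-identityʳ h)) (trans at-k (+-identityʳ k)))
Rebounds⇒Window k (suc c) (suc h) (D ∷ xs) (_ , rbs) nn (suc i) rest (s≤s i<c) dropped at-k =
  Rebounds⇒Window k c h xs rbs nn i rest i<c dropped (suc-injective (trans at-k (+-suc k _)))

Window⇒Rebounds : ∀ k c h xs → StaysNonneg h xs → Window k c h xs → Rebounds k c h xs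
Window⇒Rebounds k zero    h       xs       _  _ = tt
Window⇒Rebounds k (suc c) h       []       _  _ = tt
Window⇒Rebounds k (suc c) h       (U ∷ xs) nn w = Window⇒Rebounds k c (suc h) xs nn
  (λ i rest i<c dropped at-k → w (suc i) rest (s≤s i<c) dropped (trans (+-suc h _) at-k))
Window⇒Rebounds k (suc c) (suc h) (D ∷ xs) nn w =
  (λ h≡k → w zero xs (s≤s z≤n) refl (trans (+-identityʳ (suc h)) (trans h≡k (sym (+-identityʳ k))))) ,
  Window⇒Rebounds k c h xs nn
    (λ i rest i<c dropped at-k → w (suc i) rest (s≤s i<c) dropped (trans (cong suc at-k) (sym (+-suc k _))))

StaysNonneg⇒heights : ∀ xs → StaysNonneg 0 xs → ∀ i → pos 0 ≤ℤ height (take i xs)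
StaysNonneg⇒heights xs nn i = subst (pos 0 ≤ℤ_) (sym (height≡ups⊖downs (take i xs)))
  (≤⇒0≤⊖ _ _ (StaysNonneg⇒prefixes 0 xs nn i))

heights⇒StaysNonneg : ∀ xs → (∀ i → pos 0 ≤ℤ height (take i xs)) → StaysNonneg 0 xs
heights⇒StaysNonneg xs ok = prefixes⇒StaysNonneg 0 xs
  (λ i → 0≤⊖⇒≤ _ _ (subst (pos 0 ≤ℤ_) (height≡ups⊖downs (take i xs)) (ok i)))

height≡⇒balance : ∀ k xs → height xs ≡ pos k → ups xs ≡ k + downs xs
height≡⇒balance k xs eq = trans (⊖≡+⇒≡+ _ _ k (trans (sym (height≡ups⊖downs xs)) eq)) (+-comm (downs xs) k)

balance⇒height≡ : ∀ k xs → ups xs ≡ k + downs xs → height xs ≡ pos k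
balance⇒height≡ k xs eq = trans (height≡ups⊖downs xs) (≡+⇒⊖≡+ _ _ k (trans eq (+-comm k (downs xs))))

EndsWithD : List Step → Set
EndsWithD t = t ≡ [] ⊎ ∃ λ t' → t ≡ t' ++ D ∷ []

EndsWithD-tail : ∀ x y t → EndsWithD (x ∷ y ∷ t) → EndsWithD (y ∷ t)
EndsWithD-tail x y t (inj₁ ())
EndsWithD-tail x y t (inj₂ ([] , ()))
EndsWithD-tail x y t (inj₂ (_ ∷ t' , eq)) = inj₂ (t' , ∷-injectiveʳ eq)

EndsWithD-U : ∀ t → EndsWithD (U ∷ t) → 1 ≤ downs t
EndsWithD-U t (inj₁ ())
EndsWithD-U t (inj₂ ([] , ()))
EndsWithD-U t (inj₂ (_ ∷ t' , refl)) =
  ≤-trans (s≤s z≤n) (≤-reflexive (sym (trans (downs-++ t' (D ∷ [])) (+-comm (downs t') 1))))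

module Filling (k n : ℕ) where
  open Machine k n

  HolesInReach : State → Set
  HolesInReach s = All (λ y → cursor s ≤ y + k) (holes s)

  -- In a successful run a block of length ≥ 2 only grows when there is no hole.
  ShortBlock : State → Set
  ShortBlock s = holes s ≡ [] ⊎ block s ≤ 1

  step-keeps-lost-hole : ∀ s x {s'} y → step s x ≡ just s' → y ∈ holes s → y + k < cursor s →
    y ∈ holes s' × y + k < cursor s'
  step-keeps-lost-hole (st a zero    F) D y refl y∈ lost = there y∈ , m≤n⇒m≤1+n lost
  step-keeps-lost-hole (st a (suc r) F) D y refl y∈ lost = y∈ , m≤n⇒m≤1+n lost
  step-keeps-lost-hole s U y eq y∈ lost = arrival (arrive-inv s eq) y∈ lost
    where
    arrival : ∀ {s s'} → Arrival s s' → y ∈ holes s → y + k < cursor s → y ∈ holes s' × y + k < cursor s'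
    arrival (atCursor _)      y∈         lost = y∈ , lost
    arrival (behind a≤y+k)    (here refl) lost = ⊥-elim (<⇒≱ lost a≤y+k)
    arrival (behind _)        (there y∈)  lost = y∈ , lost
    arrival (ahead _ _)       y∈         lost = y∈ , lost

  Run-keeps-lost-hole : ∀ {s t e} y → Run s t e → y ∈ holes s → y + k < cursor s → y ∈ holes e
  Run-keeps-lost-hole y []                   y∈ lost = y∈
  Run-keeps-lost-hole y (_∷_ {x = x} eq r) y∈ lost with step-keeps-lost-hole _ x y eq y∈ lost
  ... | y∈' , lost' = Run-keeps-lost-hole y r y∈' lost'

  Run-fills⇒HolesInReach : ∀ {s t e} → Run s t e → holes e ≡ [] → HolesInReach s
  Run-fills⇒HolesInReach {s} r filled = inReach (holes s) (λ y∈ → y∈)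
    where
    inReach : ∀ G → (∀ {y} → y ∈ G → y ∈ holes s) → All (λ y → cursor s ≤ y + k) G
    inReach []      _   = []
    inReach (y ∷ G) G⊆ with cursor s ≤? y + k
    ... | yes a≤y+k = a≤y+k ∷ inReach G (λ y∈ → G⊆ (there y∈))
    ... | no  a≰y+k with subst (y ∈_) filled (Run-keeps-lost-hole y r (G⊆ (here refl)) (≰⇒> a≰y+k))
    ...   | ()

  length-holes≤k : ∀ s → WellFormed s → HolesInReach s → length (holes s) ≤ k
  length-holes≤k (st a r F) (l , F∈ , _ , _) inReach = +-cancelʳ-≤ (a ∸ k) (length F) k (begin
    length F + (a ∸ k) ≤⟨ length-decreasing (m∸n≤m a k) l (All.zipWith window (F∈ , inReach)) ⟩
    a                   ≤⟨ m≤n+m∸n a k ⟩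
    k + (a ∸ k)         ∎)
    where
    open ≤-Reasoning
    window : ∀ {y} → (1 ≤ y × y < a) × a ≤ y + k → a ∸ k ≤ y × y < a
    window {y} ((_ , y<a) , a≤y+k) = ≤-trans (∸-monoˡ-≤ k a≤y+k) (≤-reflexive (m+n∸n≡m y k)) , y<a

  advance-ShortBlock : ∀ s → ShortBlock s → ShortBlock (advance s)
  advance-ShortBlock (st a zero    F) _           = inj₂ z≤n
  advance-ShortBlock (st a (suc r) F) (inj₁ F≡[]) = inj₁ F≡[]
  advance-ShortBlock (st a (suc r) F) (inj₂ r≤0)  = inj₂ (≤-trans (n≤1+n r) r≤0)

  ShortBlock-pop : ∀ {a r t F} → ShortBlock (st a r (t ∷ F)) → ShortBlock (st a r F)
  ShortBlock-pop (inj₁ ())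
  ShortBlock-pop (inj₂ r≤1) = inj₂ r≤1

  ahead-ShortBlock : ∀ {a r} F → OutOfReach k a F → HolesInReach (st a (suc r) F) → ShortBlock (st a (suc (suc r)) F)
  ahead-ShortBlock []      _       _           = inj₁ refl
  ahead-ShortBlock (_ ∷ _) t+k<a (a≤t+k ∷ _) = ⊥-elim (<⇒≱ t+k<a a≤t+k)

  -- After j steps the deepest hole f₀ has just been filled, from a cursor within its reach.
  DeepestFilled : List Step → State → ℕ → Set
  DeepestFilled t s f₀ = ∃ λ j → j ≤ length t
    × ups (take j t) + block s ≡ downs (take j t) + 1 + length (holes s)
    × cursor s + downs (take j t) ≤ f₀ + k

  deepest-filled : ∀ {s t e} → Run s t e → holes e ≡ [] → ShortBlock s →
    ∀ G f₀ → holes s ≡ G ++ f₀ ∷ [] → DeepestFilled t s f₀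
  deepest-filled-U : ∀ {s s' t e} → Arrival s s' → Run s' t e → holes e ≡ [] → ShortBlock s → HolesInReach s →
    ∀ G f₀ → holes s ≡ G ++ f₀ ∷ [] → DeepestFilled (U ∷ t) s f₀

  deepest-filled [] filled _ G f₀ eq = ⊥-elim (++-∷ʳ-≢-[] G f₀ (trans (sym eq) filled))
  deepest-filled (_∷_ {s = st a (suc b) F} {x = D} refl run) filled short G f₀ eq
    with deepest-filled run filled (advance-ShortBlock (st a _ F) short) G f₀ eq
  ... | j , j≤ , balance , reach =
    suc j , s≤s j≤ , trans (+-suc _ b) (cong suc balance) , ≤-trans (≤-reflexive (+-suc a _)) reach
  deepest-filled (_∷_ {s = st a zero F} {x = D} refl run) filled short G f₀ eq
    with deepest-filled run filled (advance-ShortBlock (st a _ F) short) (a ∷ G) f₀ (cong (a ∷_) eq)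
  ... | j , j≤ , balance , reach =
    suc j , s≤s j≤ , trans balance (+-suc (downs (take j _) + 1) (length F)) , ≤-trans (≤-reflexive (+-suc a _)) reach
  deepest-filled {s} r@(_∷_ {x = U} eq run) filled short G f₀ eqF =
    deepest-filled-U (arrive-inv s eq) run filled short (Run-fills⇒HolesInReach r filled) G f₀ eqF

  deepest-filled-U {t = t} (atCursor _) run filled _ _ G f₀ eqF with deepest-filled run filled (inj₂ ≤-refl) G f₀ eqF
  ... | j , j≤ , balance , reach =
    suc j , s≤s j≤ , trans (+-identityʳ _) (trans (+-comm 1 (ups (take j t))) balance) , reach
  deepest-filled-U (behind {a} {zero} a≤f₀+k) _ _ _ _ [] f₀ refl =
    1 , s≤s z≤n , refl , ≤-trans (≤-reflexive (+-identityʳ a)) a≤f₀+k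
  deepest-filled-U (behind {r = suc _} _) _ _ (inj₁ ())        _ _ _ _
  deepest-filled-U (behind {r = suc _} _) _ _ (inj₂ (s≤s ())) _ _ _ _
  deepest-filled-U {t = t} (behind {a} {r} {t₀} {F} _) run filled short _ (g ∷ G) f₀ refl
    with deepest-filled run filled (ShortBlock-pop {a} {suc r} {t₀} {G ++ f₀ ∷ []} short) G f₀ refl
  ... | j , j≤ , balance , reach =
    suc j , s≤s j≤ , trans (cong suc balance) (sym (+-suc (downs (take j t) + 1) (length F))) , reach
  deepest-filled-U (ahead {F = []} _ _)    _ _ _ _ G f₀ eqF = ⊥-elim (++-∷ʳ-≢-[] G f₀ (sym eqF))
  deepest-filled-U (ahead {F = _ ∷ _} t+k<a _) _ _ _ (a≤t+k ∷ _) _ _ _ = ⊥-elim (<⇒≱ t+k<a a≤t+k)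

  crossing-rebounds : ∀ {s t e} → Run (advance s) t e → holes e ≡ [] → WellFormed s → ShortBlock s →
    length (holes s) ≡ block s → Rebound k (t ++ replicate k D)
  crossing-rebounds {st a zero []} run filled _ _ _ with deepest-filled run filled (inj₂ z≤n) [] a refl
  ... | j , j≤ , balance , reach =
    Rebound-of-prefix k _ _ j j≤ (trans (sym (+-identityʳ _)) (trans balance (+-assoc _ 1 1)))
      (+-cancelˡ-≤ a _ k (≤-trans (≤-reflexive (+-suc a _)) reach))
  crossing-rebounds {st a (suc zero) (f₀ ∷ [])} run filled (_ , (_ , f₀<a) ∷ _ , _) _ _
    with deepest-filled run filled (inj₂ z≤n) [] f₀ refl
  ... | j , j≤ , balance , reach =
    Rebound-of-prefix k _ _ j j≤ (trans (sym (+-identityʳ _)) (trans balance (+-assoc _ 1 1)))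
      (+-cancelˡ-≤ a _ k (≤-trans (≤-reflexive (+-suc a _)) (≤-trans reach (+-monoˡ-≤ k (<⇒≤ f₀<a)))))
  crossing-rebounds {st a (suc (suc r)) (_ ∷ _)} _ _ _ (inj₁ ())        _
  crossing-rebounds {st a (suc (suc r)) (_ ∷ _)} _ _ _ (inj₂ (s≤s ())) _

  Conditions : ℕ → List Step → Set
  Conditions h t = StaysNonneg h (t ++ replicate k D) × Rebounds k (length t) h (t ++ replicate k D)

  -- h is the height of the full path; it equals k + block − #holes.
  Run⇒Conditions : ∀ {s t e} → Run s t e → holes e ≡ [] → WellFormed s → ShortBlock s →
    ∀ h → h + length (holes s) ≡ k + block s → Conditions h t
  Arrival⇒Conditions : ∀ {s s' t e} → Arrival s s' → Run s' t e → holes e ≡ [] → WellFormed s → ShortBlock s →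
    HolesInReach s → ∀ h → h + length (holes s) ≡ k + block s → Conditions (suc h) t

  Run⇒Conditions {st a r F} [] refl _ _ h eq =
    StaysNonneg-replicate-D k h (≤-trans (m≤m+n k r) (≤-reflexive (trans (sym eq) (+-identityʳ h)))) , tt
  Run⇒Conditions r@(_∷_ {s = st a (suc b) F} {x = D} refl run) filled wf short zero eq =
    ⊥-elim (<⇒≱ (m<m+n k (s≤s z≤n)) (subst (_≤ k) eq (length-holes≤k _ wf (Run-fills⇒HolesInReach r filled))))
  Run⇒Conditions r@(_∷_ {s = st a (suc b) F} {x = D} refl run) filled wf short (suc h) eq =
    proj₁ IH , (λ h≡k → crossing-rebounds {st a (suc b) F} run filled wf short (cancel h≡k)) , proj₂ IH
    where
    IH = Run⇒Conditions run filled (advance-wf _ wf) (advance-ShortBlock (st a _ F) short)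
           h (suc-injective (trans eq (+-suc k b)))
    cancel : suc h ≡ k → length F ≡ suc b
    cancel refl = +-cancelˡ-≡ (suc h) (length F) (suc b) eq
  Run⇒Conditions r@(_∷_ {s = st a zero F} {x = D} refl run) filled wf short zero eq =
    ⊥-elim (<⇒≱ ≤-refl (≤-trans (length-holes≤k _ (advance-wf _ wf) (Run-fills⇒HolesInReach run filled))
                                 (≤-reflexive (trans (sym (+-identityʳ k)) (sym eq)))))
  Run⇒Conditions r@(_∷_ {s = st a zero F} {x = D} refl run) filled wf short (suc h) eq =
    proj₁ IH , (λ h≡k → crossing-rebounds {st a zero F} run filled wf short (cancel h≡k)) , proj₂ IH
    where
    IH = Run⇒Conditions run filled (advance-wf _ wf) (advance-ShortBlock (st a _ F) short)
           h (trans (+-suc h (length F)) eq)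
    cancel : suc h ≡ k → length F ≡ 0
    cancel refl = +-cancelˡ-≡ (suc h) (length F) 0 eq
  Run⇒Conditions {s} r@(_∷_ {x = U} eq run) filled wf short h balance =
    Arrival⇒Conditions (arrive-inv s eq) run filled wf short (Run-fills⇒HolesInReach r filled) h balance

  Arrival⇒Conditions arr@(atCursor _) run filled wf _ _ h eq =
    Run⇒Conditions run filled (Arrival-wf arr wf) (inj₂ ≤-refl) (suc h)
      (trans (cong suc eq) (trans (cong suc (+-identityʳ k)) (sym (+-comm k 1))))
  Arrival⇒Conditions arr@(behind {a} {r} {t} {G} _) run filled wf short _ h eq =
    Run⇒Conditions run filled (Arrival-wf arr wf) (ShortBlock-pop {a} {suc r} {t} {G} short) (suc h)
      (trans (sym (+-suc h (length G))) eq)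
  Arrival⇒Conditions arr@(ahead {a} {r} {F} out _) run filled wf _ inReach h eq =
    Run⇒Conditions run filled (Arrival-wf arr wf) (ahead-ShortBlock F out inReach) (suc h)
      (trans (cong suc eq) (sym (+-suc k (suc r))))

  -- t is the unread part of the path before its final k down steps.
  record Ready (s : State) (t : List Step) (h : ℕ) : Set where
    field
      wf         : WellFormed s
      short      : ShortBlock s
      balance    : h + length (holes s) ≡ k + block s
      ends-at-k  : h + ups t ≡ k + downs t
      ends-at-n  : cursor s + downs t ≡ suc n
      ends-with-D : EndsWithD t
      nonneg     : StaysNonneg h (t ++ replicate k D)
      rebounds   : Rebounds k (pred (length t)) h (t ++ replicate k D)
      deepest    : ∀ G f₀ → holes s ≡ G ++ f₀ ∷ [] → DeepestFilled (t ++ replicate k D) s f₀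

  Ready-advance-block : ∀ {a b F y t h} → Ready (st a (suc b) F) (D ∷ y ∷ t) (suc h) →
    Ready (st (suc a) b F) (y ∷ t) h
  Ready-advance-block {a} {b} {F} {y} {t} {h} R = record
    { wf          = advance-wf _ wf
    ; short       = advance-ShortBlock (st a (suc b) F) short
    ; balance     = suc-injective (trans balance (+-suc k b))
    ; ends-at-k   = suc-injective (trans ends-at-k (+-suc k (downs (y ∷ t))))
    ; ends-at-n   = trans (sym (+-suc a (downs (y ∷ t)))) ends-at-n
    ; ends-with-D = EndsWithD-tail D y t ends-with-D
    ; nonneg      = nonneg
    ; rebounds    = proj₂ rebounds
    ; deepest     = deepest′
    }
    where
    open Ready R
    deepest′ : ∀ G f₀ → F ≡ G ++ f₀ ∷ [] → DeepestFilled ((y ∷ t) ++ replicate k D) (st (suc a) b F) f₀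
    deepest′ G f₀ eq with deepest G f₀ eq | short
    ... | zero , _ , balance₀ , _ | inj₁ F≡[] = ⊥-elim (++-∷ʳ-≢-[] G f₀ (trans (sym eq) F≡[]))
    ... | zero , _ , balance₀ , _ | inj₂ (s≤s z≤n) with G | eq | balance₀
    ...   | [] | refl | ()
    ...   | _ ∷ _ | refl | ()
    deepest′ G f₀ eq | suc j , s≤s j≤ , balance′ , reach | _ =
      j , j≤ , suc-injective (trans (sym (+-suc _ b)) balance′) , ≤-trans (≤-reflexive (sym (+-suc a _))) reach

  Ready-advance-hole : ∀ {a F y t h} → Ready (st a zero F) (D ∷ y ∷ t) (suc h) →
    Ready (st (suc a) zero (a ∷ F)) (y ∷ t) h
  Ready-advance-hole {a} {F} {y} {t} {h} R = record
    { wf          = advance-wf _ wf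
    ; short       = inj₂ z≤n
    ; balance     = trans (+-suc h (length F)) balance
    ; ends-at-k   = suc-injective (trans ends-at-k (+-suc k (downs (y ∷ t))))
    ; ends-at-n   = trans (sym (+-suc a (downs (y ∷ t)))) ends-at-n
    ; ends-with-D = EndsWithD-tail D y t ends-with-D
    ; nonneg      = nonneg
    ; rebounds    = proj₂ rebounds
    ; deepest     = deepest′
    }
    where
    open Ready R
    rest = (y ∷ t) ++ replicate k D
    deepest′ : ∀ G f₀ → a ∷ F ≡ G ++ f₀ ∷ [] → DeepestFilled rest (st (suc a) zero (a ∷ F)) f₀
    -- a is the only hole, so this D step is a crossing; its rebound fills a
    deepest′ [] f₀ refl
      with Rebound⇒prefix k rest (proj₁ rebounds (trans (sym (+-identityʳ (suc h))) (trans balance (+-identityʳ k))))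
    ... | j , j≤ , rise , d<k =
      j , j≤ , trans (+-identityʳ _) (trans rise (sym (+-assoc _ 1 1))) ,
      ≤-trans (≤-reflexive (sym (+-suc a _))) (+-monoʳ-≤ a d<k)
    deepest′ (_ ∷ G) f₀ refl with deepest G f₀ refl
    ... | zero  , _ , () , _
    ... | suc j , s≤s j≤ , balance′ , reach =
      j , j≤ , trans balance′ (sym (+-suc (downs (take j rest) + 1) (length F))) , ≤-trans (≤-reflexive (sym (+-suc a _))) reach

  Ready-atCursor : ∀ {a F y t h} → Ready (st a zero F) (U ∷ y ∷ t) h →
    a ≤ n × Ready (st a 1 F) (y ∷ t) (suc h)
  Ready-atCursor {a} {F} {y} {t} {h} R = a≤n , record
    { wf          = Arrival-wf (atCursor a≤n) wf
    ; short       = inj₂ ≤-refl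
    ; balance     = trans (cong suc balance) (trans (cong suc (+-identityʳ k)) (+-comm 1 k))
    ; ends-at-k   = trans (sym (+-suc h (ups (y ∷ t)))) ends-at-k
    ; ends-at-n   = ends-at-n
    ; ends-with-D = EndsWithD-tail U y t ends-with-D
    ; nonneg      = nonneg
    ; rebounds    = rebounds
    ; deepest     = deepest′
    }
    where
    open Ready R
    a≤n : a ≤ n
    a≤n = s≤s⁻¹ (≤-trans (≤-reflexive (+-comm 1 a))
            (≤-trans (+-monoʳ-≤ a (EndsWithD-U (y ∷ t) ends-with-D)) (≤-reflexive ends-at-n)))
    deepest′ : ∀ G f₀ → F ≡ G ++ f₀ ∷ [] → DeepestFilled ((y ∷ t) ++ replicate k D) (st a 1 F) f₀
    deepest′ G f₀ eq with deepest G f₀ eq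
    ... | zero  , _ , () , _
    ... | suc j , s≤s j≤ , balance′ , reach =
      j , j≤ , trans (+-comm _ 1) (trans (sym (+-identityʳ _)) balance′) , reach

  Ready-ahead : ∀ {a b y t h} → Ready (st a (suc b) []) (U ∷ y ∷ t) h →
    a + suc b ≤ n × Ready (st a (suc (suc b)) []) (y ∷ t) (suc h)
  Ready-ahead {a} {b} {y} {t} {h} R = a+b<n , record
    { wf          = Arrival-wf (ahead tt a+b<n) wf
    ; short       = inj₁ refl
    ; balance     = trans (cong suc balance) (sym (+-suc k (suc b)))
    ; ends-at-k   = trans (sym (+-suc h (ups (y ∷ t)))) ends-at-k
    ; ends-at-n   = ends-at-n
    ; ends-with-D = EndsWithD-tail U y t ends-with-D
    ; nonneg      = nonneg
    ; rebounds    = rebounds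
    ; deepest     = λ G f₀ eq → ⊥-elim (++-∷ʳ-≢-[] G f₀ (sym eq))
    }
    where
    open Ready R
    u = ups (y ∷ t)
    d = downs (y ∷ t)
    -- with no holes the height is k + block, so the block still fits before spot n + 1
    block+u≡d : suc b + suc u ≡ d
    block+u≡d = +-cancelˡ-≡ k _ _ (begin
      k + (suc b + suc u) ≡⟨ +-assoc k (suc b) (suc u) ⟨
      k + suc b + suc u   ≡⟨ cong (_+ suc u) (trans (sym (+-identityʳ h)) balance) ⟨
      h + suc u           ≡⟨ ends-at-k ⟩
      k + d               ∎)
      where open ≡-Reasoning
    a+b<n : a + suc b ≤ n
    a+b<n = s≤s⁻¹ (begin
      suc (a + suc b)         ≡⟨ +-comm 1 (a + suc b) ⟩
      a + suc b + 1           ≤⟨ +-monoʳ-≤ (a + suc b) (s≤s (z≤n {u})) ⟩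
      a + suc b + suc u       ≡⟨ +-assoc a (suc b) (suc u) ⟩
      a + (suc b + suc u)     ≡⟨ cong (a +_) block+u≡d ⟩
      a + d                   ≡⟨ ends-at-n ⟩
      suc n                   ∎)
      where open ≤-Reasoning

  Ready-behind : ∀ {a t₀ G y t h} → Ready (st a 1 (t₀ ∷ G)) (U ∷ y ∷ t) h →
    a ≤ t₀ + k × Ready (st a 1 G) (y ∷ t) (suc h)
  Ready-behind {a} {t₀} {G} {y} {t} {h} R = a≤t₀+k , record
    { wf          = Arrival-wf (behind a≤t₀+k) wf
    ; short       = inj₂ ≤-refl
    ; balance     = trans (sym (+-suc h (length G))) balance
    ; ends-at-k   = trans (sym (+-suc h (ups (y ∷ t)))) ends-at-k
    ; ends-at-n   = ends-at-n
    ; ends-with-D = EndsWithD-tail U y t ends-with-D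
    ; nonneg      = nonneg
    ; rebounds    = rebounds
    ; deepest     = deepest′
    }
    where
    open Ready R
    a≤t₀+k : a ≤ t₀ + k
    a≤t₀+k with last-of t₀ G
    ... | G′ , f₀ , eq with deepest G′ f₀ eq
    ...   | _ , _ , _ , reach =
      ≤-trans (m≤m+n a _) (≤-trans reach (+-monoˡ-≤ k (Linked->-last (proj₁ wf) eq)))
    deepest′ : ∀ G′ f₀ → G ≡ G′ ++ f₀ ∷ [] → DeepestFilled ((y ∷ t) ++ replicate k D) (st a 1 G) f₀
    deepest′ G′ f₀ eq with deepest (t₀ ∷ G′) f₀ (cong (t₀ ∷_) eq)
    ... | zero  , _ , () , _
    ... | suc j , s≤s j≤ , balance′ , reach = j , j≤ , suc-injective (trans balance′ (+-suc _ (length G))) , reach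

  Ready⇒Run : ∀ s t h → Ready s t h → Runs s t
  Ready⇒Run s [] _ _ = s , []
  Ready⇒Run s (D ∷ []) _ _ = advance s , refl ∷ []
  Ready⇒Run s (U ∷ []) _ R with EndsWithD-U [] (Ready.ends-with-D R)
  ... | ()
  Ready⇒Run s (D ∷ y ∷ t) zero R = ⊥-elim (Ready.nonneg R)
  Ready⇒Run (st a zero F) (D ∷ y ∷ t) (suc h) R =
    Runs-∷ refl (Ready⇒Run _ (y ∷ t) h (Ready-advance-hole R))
  Ready⇒Run (st a (suc b) F) (D ∷ y ∷ t) (suc h) R =
    Runs-∷ refl (Ready⇒Run _ (y ∷ t) h (Ready-advance-block R))
  Ready⇒Run (st a zero F) (U ∷ y ∷ t) h R =
    let a≤n , R′ = Ready-atCursor R in Runs-∷ (Arrival⇒arrive (atCursor a≤n)) (Ready⇒Run _ (y ∷ t) (suc h) R′)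
  Ready⇒Run (st a (suc b) []) (U ∷ y ∷ t) h R =
    let a+b<n , R′ = Ready-ahead R in Runs-∷ (Arrival⇒arrive (ahead tt a+b<n)) (Ready⇒Run _ (y ∷ t) (suc h) R′)
  Ready⇒Run (st a 1 (t₀ ∷ G)) (U ∷ y ∷ t) h R =
    let a≤t₀+k , R′ = Ready-behind R in Runs-∷ (Arrival⇒arrive (behind a≤t₀+k)) (Ready⇒Run _ (y ∷ t) (suc h) R′)
  Ready⇒Run (st a (suc (suc b)) (_ ∷ _)) (U ∷ y ∷ t) h R with Ready.short R
  ... | inj₁ ()
  ... | inj₂ (s≤s ())


  -- Every U step adds one to cursor + block − #holes and every D step leaves it unchanged;
  -- stated without subtraction.
  Counts : State → List Step → State → Set
  Counts s t e = cursor e ≡ cursor s + downs t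
    × cursor e + block e + length (holes s) ≡ cursor s + block s + length (holes e) + ups t

  Run-counts : ∀ {s t e} → Run s t e → Counts s t e
  Run-counts {st a r F} [] = sym (+-identityʳ a) , sym (+-identityʳ _)
  Run-counts {e = e} (_∷_ {s = st a (suc r) F} {x = D} {xs = t} refl run) with Run-counts run
  ... | moved , counted =
    trans moved (sym (+-suc a _)) , trans counted (cong (λ z → z + length (holes e) + ups t) (sym (+-suc a r)))
  Run-counts {e = e} (_∷_ {s = st a zero F} {x = D} {xs = t} refl run) with Run-counts run
  ... | moved , counted = trans moved (sym (+-suc a _)) ,
    suc-injective (trans (sym (+-suc (cursor e + block e) (length F))) (trans counted (shuffle a (length (holes e)) (ups t))))
    where
    shuffle : ∀ a l u → suc a + 0 + l + u ≡ suc (a + 0 + l + u)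
    shuffle = solve-∀
  Run-counts {s} {U ∷ t} {e} (_∷_ {x = U} eq run) = arrival (arrive-inv s eq) (Run-counts run)
    where
    arrival : ∀ {s s'} → Arrival s s' → Counts s' t e → Counts s (U ∷ t) e
    arrival (atCursor {a} _) (moved , counted) = moved , trans counted (shuffle a _ _)
      where
      shuffle : ∀ a l u → a + 1 + l + u ≡ a + 0 + l + suc u
      shuffle = solve-∀
    arrival (behind {a} {r} {_} {G} _) (moved , counted) =
      moved , trans (+-suc _ (length G)) (trans (cong suc counted) (shuffle a r _ _))
      where
      shuffle : ∀ a r l u → suc (a + suc r + l + u) ≡ a + suc r + l + suc u
      shuffle = solve-∀
    arrival (ahead {a} {r} _ _) (moved , counted) = moved , trans counted (shuffle a r _ _)
      where
      shuffle : ∀ a r l u → a + suc (suc r) + l + u ≡ a + suc r + l + suc u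
      shuffle = solve-∀

  Run-fills-lot : ∀ {t e} → Run initial t e → ups t ≡ n → downs t ≡ n → WellFormed e → holes e ≡ []
  Run-fills-lot {t} {st a zero F} run ups≡n downs≡n _ with Run-counts run
  ... | moved , counted = empty (+-cancelʳ-≡ n (length F) 0 (sym (suc-injective (begin
      suc n                  ≡⟨ trans moved (cong suc downs≡n) ⟨
      a                      ≡⟨ trans (+-identityʳ (a + 0)) (+-identityʳ a) ⟨
      a + 0 + 0              ≡⟨ counted ⟩
      suc (length F + ups t) ≡⟨ cong (λ u → suc (length F + u)) ups≡n ⟩
      suc (length F + n)     ∎))))
    where
    open ≡-Reasoning
    empty : ∀ {G : List ℕ} → length G ≡ 0 → G ≡ []
    empty {[]} _ = refl
  Run-fills-lot {t} {st a (suc r) F} run ups≡n downs≡n (_ , _ , inj₁ () , _)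
  Run-fills-lot {t} {st a (suc r) F} run ups≡n downs≡n (_ , _ , inj₂ a+r≤ , _) =
    ⊥-elim (<⇒≱ (m<m+n (suc n) (s≤s z≤n)) (subst (λ z → z + suc r ≤ suc n) a≡ a+r≤))
    where
    a≡ : a ≡ suc n
    a≡ = trans (proj₁ (Run-counts run)) (cong suc downs≡n)

frame : ℕ → List Step → List Step
frame k mid = replicate k U ++ (mid ++ replicate k D)

ups-frame : ∀ k mid → ups (frame k mid) ≡ k + ups mid
ups-frame k mid = begin
  ups (frame k mid)                                      ≡⟨ ups-++ (replicate k U) _ ⟩
  ups (replicate k U) + ups (mid ++ replicate k D)       ≡⟨ cong₂ _+_ (ups-replicate-U k) (ups-++ mid _) ⟩
  k + (ups mid + ups (replicate k D))                    ≡⟨ cong (λ z → k + (ups mid + z)) (ups-replicate-D k) ⟩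
  k + (ups mid + 0)                                      ≡⟨ cong (k +_) (+-identityʳ _) ⟩
  k + ups mid                                            ∎
  where open ≡-Reasoning

downs-frame : ∀ k mid → downs (frame k mid) ≡ downs mid + k
downs-frame k mid = begin
  downs (frame k mid)                                  ≡⟨ downs-++ (replicate k U) _ ⟩
  downs (replicate k U) + downs (mid ++ replicate k D) ≡⟨ cong₂ _+_ (downs-replicate-U k) (downs-++ mid _) ⟩
  downs mid + downs (replicate k D)                    ≡⟨ cong (downs mid +_) (downs-replicate-D k) ⟩
  downs mid + k                                        ∎
  where open ≡-Reasoning

frame-∷ʳ-D : ∀ k mid′ → frame k (mid′ ++ D ∷ []) ≡ (replicate k U ++ mid′) ++ replicate (suc k) D
frame-∷ʳ-D k mid′ = trans (cong (replicate k U ++_) (++-assoc mid′ (D ∷ []) (replicate k D)))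
  (sym (++-assoc (replicate k U) mid′ (D ∷ replicate k D)))

length-U^-++ : ∀ k mid′ → length (replicate k U ++ mid′) ≡ k + length mid′
length-U^-++ k mid′ = trans (length-++ (replicate k U)) (cong (_+ length mid′) (length-replicate k))

length-frame-∷ʳ-D : ∀ k mid′ → length (frame k (mid′ ++ D ∷ [])) ∸ suc k ≡ k + length mid′
length-frame-∷ʳ-D k mid′ = begin
  length (frame k (mid′ ++ D ∷ [])) ∸ suc k           ≡⟨ cong (λ p → length p ∸ suc k) (frame-∷ʳ-D k mid′) ⟩
  length (prefix ++ replicate (suc k) D) ∸ suc k       ≡⟨ cong (_∸ suc k) (length-++ prefix) ⟩
  length prefix + length (replicate (suc k) D) ∸ suc k ≡⟨ cong (λ l → length prefix + l ∸ suc k) (length-replicate (suc k)) ⟩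
  length prefix + suc k ∸ suc k                        ≡⟨ m+n∸n≡m (length prefix) (suc k) ⟩
  length prefix                                        ≡⟨ length-U^-++ k mid′ ⟩
  k + length mid′                                      ∎
  where
  open ≡-Reasoning
  prefix = replicate k U ++ mid′

drop-frame-∷ʳ-D : ∀ k mid′ → let p = frame k (mid′ ++ D ∷ []) in drop (length p ∸ suc k) p ≡ replicate (suc k) D
drop-frame-∷ʳ-D k mid′ = begin
  drop (length p ∸ suc k) p
    ≡⟨ cong₂ drop (trans (length-frame-∷ʳ-D k mid′) (sym (length-U^-++ k mid′))) (frame-∷ʳ-D k mid′) ⟩
  drop (length prefix) (prefix ++ replicate (suc k) D) ≡⟨ drop-length-++ prefix _ ⟩
  replicate (suc k) D                                  ∎
  where
  open ≡-Reasoning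
  p = frame k (mid′ ++ D ∷ [])
  prefix = replicate k U ++ mid′

pred-length-∷ʳ : ∀ {A : Set} (xs : List A) x → pred (length (xs ++ x ∷ [])) ≡ length xs
pred-length-∷ʳ []       x = refl
pred-length-∷ʳ (_ ∷ []) x = refl
pred-length-∷ʳ (_ ∷ y ∷ xs) x = cong suc (pred-length-∷ʳ (y ∷ xs) x)

-- The part of a path between its first k up steps and its last k down steps.
record Middle (k n : ℕ) (mid : List Step) : Set where
  field
    ups≡n       : ups mid ≡ n
    downs≡n     : downs mid ≡ n
    ends-with-D : ∃ λ mid′ → mid ≡ mid′ ++ D ∷ []
    nonneg      : StaysNonneg k (mid ++ replicate k D)
    rebounds    : Rebounds k (pred (length mid)) k (mid ++ replicate k D)

Middle⇒IsCorPath : ∀ k n mid → Middle k n mid → IsCorPath k n (frame k mid)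
Middle⇒IsCorPath k n mid M with Middle.ends-with-D M
... | mid′ , refl = (length-p , height-p , nonneg-p) , take-replicate-++ k U _ , drop-frame-∷ʳ-D k mid′ , window
  where
  open Middle M using (ups≡n; downs≡n; nonneg; rebounds)
  p = frame k mid
  ups-p : ups p ≡ n + k
  ups-p = trans (ups-frame k mid) (trans (cong (k +_) ups≡n) (+-comm k n))
  downs-p : downs p ≡ n + k
  downs-p = trans (downs-frame k mid) (cong (_+ k) downs≡n)
  length-p : length p ≡ 2 * (n + k)
  length-p = trans (length≡ups+downs p) (trans (cong₂ _+_ ups-p downs-p) (cong (n + k +_) (sym (+-identityʳ (n + k)))))
  height-p : height p ≡ pos 0
  height-p = balance⇒height≡ 0 p (trans ups-p (sym downs-p))
  nonneg-p : ∀ i → pos 0 ≤ℤ height (take i p)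
  nonneg-p = StaysNonneg⇒heights p (subst (λ A → A) (sym (StaysNonneg-U^ 0 k _)) nonneg)
  p-rebounds : Rebounds k (k + length mid′) 0 p
  p-rebounds = subst (λ A → A) (sym (Rebounds-U^ k 0 k _ _))
    (subst (λ c → Rebounds k c k (mid ++ replicate k D)) (pred-length-∷ʳ mid′ D) rebounds)
  window : ∀ i rest → i < length p ∸ suc k → drop i p ≡ D ∷ rest → height (take i p) ≡ pos k → Rebound k rest
  window i rest i< dropped at-k = Rebounds⇒Window k _ 0 p p-rebounds (heights⇒StaysNonneg p nonneg-p) i rest
    (subst (i <_) (length-frame-∷ʳ-D k mid′) i<) dropped (height≡⇒balance k (take i p) at-k)

frame-decomposition : ∀ k n p → 1 ≤ n → IsCorPath k n p → ∃ λ mid′ → p ≡ frame k (mid′ ++ D ∷ [])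
frame-decomposition k n p 1≤n ((length-p , _) , prefix , suffix , _) = drop k q , (begin
  p                                             ≡⟨ take++drop≡id m p ⟨
  q ++ drop m p                                 ≡⟨ cong (q ++_) suffix ⟩
  q ++ replicate (suc k) D                      ≡⟨ cong (_++ replicate (suc k) D) q≡ ⟩
  (replicate k U ++ drop k q) ++ replicate (suc k) D ≡⟨ frame-∷ʳ-D k (drop k q) ⟨
  frame k (drop k q ++ D ∷ [])                  ∎)
  where
  open ≡-Reasoning
  m = length p ∸ suc k
  q = take m p
  k≤m : k ≤ m
  k≤m = m+n≤o⇒m≤o∸n k (subst (k + suc k ≤_) (sym length-p)
          (≤-trans (≤-reflexive (+-comm k (suc k)))
                   (+-mono-≤ (+-monoˡ-≤ k 1≤n) (≤-trans (m≤n+m k n) (≤-reflexive (sym (+-identityʳ _)))))))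
  q≡ : q ≡ replicate k U ++ drop k q
  q≡ = trans (sym (take++drop≡id k q))
    (cong (_++ drop k q) (trans (take-take k m p) (trans (cong (λ i → take i p) (m≤n⇒m⊓n≡m k≤m)) prefix)))

IsCorPath⇒Middle : ∀ k n p → 1 ≤ n → IsCorPath k n p → ∃ λ mid → p ≡ frame k mid × Middle k n mid
IsCorPath⇒Middle k n p 1≤n cp with frame-decomposition k n p 1≤n cp
IsCorPath⇒Middle k n _ 1≤n ((length-p , height-p , nonneg-p) , _ , _ , window) | mid′ , refl = mid , refl , record
  { ups≡n       = +-cancelˡ-≡ k _ _ (trans (sym (ups-frame k mid)) (trans ups-p (+-comm n k)))
  ; downs≡n     = +-cancelʳ-≡ k _ _ (trans (sym (downs-frame k mid)) (trans (sym balanced) ups-p))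
  ; ends-with-D = mid′ , refl
  ; nonneg      = subst (λ A → A) (StaysNonneg-U^ 0 k _) p-nonneg
  ; rebounds    = subst (λ c → Rebounds k c k (mid ++ replicate k D)) (sym (pred-length-∷ʳ mid′ D))
                    (subst (λ A → A) (Rebounds-U^ k 0 k _ _) (Window⇒Rebounds k _ 0 p p-nonneg p-window))
  }
  where
  mid = mid′ ++ D ∷ []
  p = frame k mid
  balanced : ups p ≡ downs p
  balanced = height≡⇒balance 0 p height-p
  ups-p : ups p ≡ n + k
  ups-p = *-cancelˡ-≡ (ups p) (n + k) 2 (begin
    2 * ups p           ≡⟨ cong (ups p +_) (trans (+-identityʳ (ups p)) balanced) ⟩
    ups p + downs p     ≡⟨ length≡ups+downs p ⟨
    length p            ≡⟨ length-p ⟩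
    2 * (n + k)         ∎)
    where open ≡-Reasoning
  p-nonneg : StaysNonneg 0 p
  p-nonneg = heights⇒StaysNonneg p nonneg-p
  p-window : Window k (k + length mid′) 0 p
  p-window i rest i< dropped at-k = window i rest (subst (i <_) (sym (length-frame-∷ʳ-D k mid′)) i<) dropped
    (balance⇒height≡ k (take i p) at-k)

module _ (k n : ℕ) where
  open Machine k n
  open Simulation k n
  open Filling k n

  AscNaples⇒Middle : ∀ α → 1 ≤ n → IsAscNaplesPF k n α → Middle k n (encode n 1 α)
  AscNaples⇒Middle α 1≤n (ascending , length-α , bounds , parks) = record
    { ups≡n       = ups≡n
    ; downs≡n     = downs≡n
    ; ends-with-D = encode-ends-with-D n 1 α 1≤n ≤n
    ; nonneg      = proj₁ conditions
    ; rebounds    = Rebounds-≤ k {length mid} k (mid ++ replicate k D) pred[n]≤n (proj₂ conditions)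
    }
    where
    ≥1 = All.map proj₁ bounds
    ≤n = All.map proj₂ bounds
    mid = encode n 1 α
    ups≡n : ups mid ≡ n
    ups≡n = trans (ups-encode n 1 α) length-α
    downs≡n : downs mid ≡ n
    downs≡n = +-cancelʳ-≡ 1 _ _ (trans (downs-encode n 1 α (s≤s z≤n) ascending ≥1 ≤n) (+-comm 1 n))
    runs : Runs initial mid
    runs = Equivalence.to (Parks⇔Runs α 1 [] initial refl initial-wf Represents-initial ascending ≥1 ≤n) parks
    conditions : Conditions k mid
    conditions = Run⇒Conditions (proj₂ runs) (Run-fills-lot (proj₂ runs) ups≡n downs≡n (Run-wf (proj₂ runs) initial-wf))
      initial-wf (inj₁ refl) k refl

  Middle⇒AscNaples : ∀ mid → Middle k n mid → IsAscNaplesPF k n (decode 1 mid) × encode n 1 (decode 1 mid) ≡ mid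
  Middle⇒AscNaples mid M with Middle.ends-with-D M
  ... | mid′ , refl = (decode-ascending 1 mid , trans (length-decode 1 mid) ups≡n , All.zip (decode-≥ 1 mid , ≤n) , parks) ,
                      encode-decode-mid
    where
    open Middle M using (ups≡n; downs≡n; nonneg; rebounds)
    encode-decode-mid : encode n 1 (decode 1 mid) ≡ mid
    encode-decode-mid = encode-decode n 1 1 mid ≤-refl (cong suc downs≡n)
    ≤n : All (_≤ n) (decode 1 mid)
    ≤n = subst (All (_≤ n)) (sym (trans (decode-++ 1 mid′ (D ∷ [])) (++-identityʳ _)))
      (subst (λ m → All (_≤ m) (decode 1 mid′)) 1+downs≡n (decode-≤ 1 mid′))
      where
      1+downs≡n : 1 + downs mid′ ≡ n
      1+downs≡n = trans (+-comm 1 (downs mid′)) (trans (sym (downs-++ mid′ (D ∷ []))) downs≡n)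
    ready : Ready initial mid k
    ready = record
      { wf          = initial-wf
      ; short       = inj₁ refl
      ; balance     = refl
      ; ends-at-k   = cong (k +_) (trans ups≡n (sym downs≡n))
      ; ends-at-n   = cong suc downs≡n
      ; ends-with-D = inj₂ (mid′ , refl)
      ; nonneg      = nonneg
      ; rebounds    = rebounds
      ; deepest     = λ G f₀ eq → ⊥-elim (++-∷ʳ-≢-[] G f₀ (sym eq))
      }
    parks : ∃ λ occ → parkAll k n [] (decode 1 mid) ≡ just occ
    parks = Equivalence.from (Parks⇔Runs (decode 1 mid) 1 [] initial refl initial-wf Represents-initial
      (decode-ascending 1 mid) (decode-≥ 1 mid) ≤n) (subst (Runs initial) (sym encode-decode-mid) (Ready⇒Run initial mid k ready))

decode-frame : ∀ k mid → decode 1 (drop k (frame k mid)) ≡ decode 1 mid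
decode-frame k mid = begin
  decode 1 (drop k (frame k mid))                         ≡⟨ cong (decode 1) (drop-replicate-++ k U _) ⟩
  decode 1 (mid ++ replicate k D)                         ≡⟨ decode-++ 1 mid _ ⟩
  decode 1 mid ++ decode (1 + downs mid) (replicate k D)  ≡⟨ cong (decode 1 mid ++_) (decode-replicate-D _ k) ⟩
  decode 1 mid ++ []                                      ≡⟨ ++-identityʳ _ ⟩
  decode 1 mid                                            ∎
  where open ≡-Reasoning

corollary3p15 : (k n : ℕ) → 1 ≤ k → 1 ≤ n →
    ∃ λ (f : List ℕ → List Step) →
      (∀ α → IsAscNaplesPF k n α → IsCorPath k n (f α))
      × (∀ α β → IsAscNaplesPF k n α → IsAscNaplesPF k n β → f α ≡ f β → α ≡ β)
      × (∀ p → IsCorPath k n p → ∃ λ α → IsAscNaplesPF k n α × f α ≡ p)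
corollary3p15 k n _ 1≤n = toPath , into , injective , onto
  where
  toPath : List ℕ → List Step
  toPath α = frame k (encode n 1 α)
  recover : ∀ α → IsAscNaplesPF k n α → decode 1 (drop k (toPath α)) ≡ α
  recover α (ascending , _ , bounds , _) =
    trans (decode-frame k (encode n 1 α)) (decode-encode n 1 α ascending (All.map proj₁ bounds))
  into : ∀ α → IsAscNaplesPF k n α → IsCorPath k n (toPath α)
  into α asc = Middle⇒IsCorPath k n _ (AscNaples⇒Middle k n α 1≤n asc)
  injective : ∀ α β → IsAscNaplesPF k n α → IsAscNaplesPF k n β → toPath α ≡ toPath β → α ≡ β
  injective α β asc-α asc-β eq = trans (sym (recover α asc-α)) (trans (cong (λ p → decode 1 (drop k p)) eq) (recover β asc-β))
  onto : ∀ p → IsCorPath k n p → ∃ λ α → IsAscNaplesPF k n α × toPath α ≡ p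
  onto p cp with IsCorPath⇒Middle k n p 1≤n cp
  ... | mid , refl , M with Middle⇒AscNaples k n mid M
  ...   | asc , encoded = decode 1 mid , asc , cong (frame k) encoded
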